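{- Let $G=(V,E^+,E^-)$ be a signed graph such that $G^+=(V,E^+)$ is a tree. If $G$ has no odd flow-star strong minor, then the matrix $A(\mathcal F)$ is balanced.
   Context: A signed graph $G=(V,E^+,E^-)$ is a (multi)graph with edge set $E=E^+\cup E^-$ partitioned into positive and negative edges. A circuit is a cycle without repeated vertices (as an edge set); a flow is a circuit with exactly one negative edge. The flow clutter $\mathcal F$ is the family of edge sets of flows of $G$, and $A(\mathcal F)$ is the 0–1 matrix whose rows are the characteristic vectors (indexed by $E$) of the members of $\mathcal F$. A strong minor of $G$ is a signed graph obtained from $G$ by a sequence of contractions of positive edges and deletions of arbitrary edges, such that no self-loops arise. A flow-star is a signed graph on vertices $v_0,v_1,\dots,v_k$, $k\ge3$, with positive edges $v_0v_i$ ($1\le i\le k$) and negative edges $v_iv_{i+1}$ ($1\le i\le k-1$) and $v_kv_1$; it is odd if $k$ is odd. $G$ has an odd flow-star strong minor if some strong minor of $G$ is isomorphic (as a signed graph) to an odd flow-star. A 0–1 matrix is balanced if it has no square submatrix which, after permuting rows and columns, is the $k\times k$ matrix with ones exactly in positions $(i,i)$ and $(i,i+1 \bmod k)$ for some odd $k\ge3$ (an odd 2-circulant submatrix). -}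

module Defs where

open import Data.Nat using (ℕ; zero; suc; _+_; _*_; _≤_)
open import Data.Nat.DivMod using (_%_; m%n<n)
open import Data.Fin using (Fin; zero; suc; toℕ; fromℕ<; punchIn; punchOut; splitAt; _≟_)
open import Data.Bool using (Bool; true; false)
open import Data.Product using (Σ; ∃; ∃-syntax; _×_; _,_; proj₁; proj₂)
open import Data.Sum using (_⊎_; inj₁; inj₂)
open import Relation.Nullary using (¬_; yes; no)
open import Relation.Binary.PropositionalEquality using (_≡_; _≢_; refl; sym)
open import Function using (_∘_)
open import Function.Bundles using (_↔_; Inverse)

-- Vertices Fin n, edges Fin m; each edge has an
-- (unordered, stored as an ordered pair) pair of ends; sign true = positive
-- (E⁺), false = negative (E⁻).

record SGraph : Set where
  field
    n    : ℕ
    m    : ℕ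
    ends : Fin m → Fin n × Fin n
    pos  : Fin m → Bool
open SGraph public

Joins : (G : SGraph) → Fin (m G) → Fin (n G) → Fin (n G) → Set
Joins G e a b = ends G e ≡ (a , b) ⊎ ends G e ≡ (b , a)

Injective : ∀ {A B : Set} → (A → B) → Set
Injective f = ∀ x y → f x ≡ f y → x ≡ y

csuc : ∀ {k} → Fin k → Fin k
csuc {suc k} i = fromℕ< (m%n<n (suc (toℕ i)) (suc k))

record Circuit (G : SGraph) : Set where
  field
    len   : ℕ                       -- length is suc len
    vtx   : Fin (suc len) → Fin (n G)
    edg   : Fin (suc len) → Fin (m G)
    vtx-inj : Injective vtx
    edg-inj : Injective edg
    joins : ∀ i → Joins G (edg i) (vtx i) (vtx (csuc i))
open Circuit public

_∈C_ : ∀ {G} → Fin (m G) → Circuit G → Set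
e ∈C C = ∃[ i ] edg C i ≡ e

IsFlow : ∀ {G} → Circuit G → Set
IsFlow {G} C = ∃[ i ] (pos G (edg C i) ≡ false ×
                      (∀ j → pos G (edg C j) ≡ false → j ≡ i))

Flow : SGraph → Set
Flow G = Σ (Circuit G) IsFlow

-- The rows of A(𝓕) are the characteristic vectors
-- of the flows' edge sets, columns are indexed by the edges.  An odd
-- 2-circulant k×k submatrix (up to row/column permutations) is given by
-- rows r : Fin k → flows and distinct columns c : Fin k → edges with
--   c j ∈ r i  ⇔  j = i or j = i+1 (mod k).

Odd2CirculantSubmatrix : SGraph → Set
Odd2CirculantSubmatrix G =
  Σ ℕ λ k → (3 ≤ k) × (k % 2 ≡ 1) ×
  Σ (Fin k → Flow G) λ r → Σ (Fin k → Fin (m G)) λ c →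
    Injective c ×
    (∀ i j → (c j ∈C proj₁ (r i) → (j ≡ i ⊎ j ≡ csuc i)) ×
             ((j ≡ i ⊎ j ≡ csuc i) → c j ∈C proj₁ (r i)))

BalancedFlowMatrix : SGraph → Set
BalancedFlowMatrix G = ¬ Odd2CirculantSubmatrix G

data PosWalk (G : SGraph) : Fin (n G) → Fin (n G) → Set where
  here : ∀ {u} → PosWalk G u u
  step : ∀ {u w v} (e : Fin (m G)) → pos G e ≡ true → Joins G e u w →
         PosWalk G w v → PosWalk G u v

PosConnected : SGraph → Set
PosConnected G = ∀ u v → PosWalk G u v

PosAcyclic : SGraph → Set
PosAcyclic G = ¬ (Σ (Circuit G) λ C → ∀ i → pos G (edg C i) ≡ true)

PosTree : SGraph → Set
PosTree G = PosConnected G × PosAcyclic G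

delete : (G : SGraph) → Fin (m G) → SGraph → Set
delete G e H = Σ (m G ≡ suc (m H)) λ { refl →
  Σ (n H ≡ n G) λ { refl → ∀ f → ends H f ≡ ends G (punchIn e f)
                                × pos H f ≡ pos G (punchIn e f) } }

merge : ∀ {k} (u v : Fin (suc k)) → u ≢ v → Fin (suc k) → Fin k
merge u v u≢v x with x ≟ v
... | yes _  = punchOut {i = v} {j = u} (u≢v ∘ sym)
... | no x≢v = punchOut {i = v} {j = x} (x≢v ∘ sym)

mapPair : ∀ {A B : Set} → (A → B) → A × A → B × B
mapPair f (a , b) = f a , f b

-- contraction of a positive non-loop edge e = uv, provided no other edge
-- becomes a self-loop (i.e. no other edge is parallel to e).
contract : (G : SGraph) → Fin (m G) → SGraph → Set
contract G e H = Σ (m G ≡ suc (m H)) λ { refl →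
  Σ (n G ≡ suc (n H)) λ { refl →
  pos G e ≡ true ×
  Σ (proj₁ (ends G e) ≢ proj₂ (ends G e)) λ d →
  (∀ f → f ≢ e → ¬ Joins G f (proj₁ (ends G e)) (proj₂ (ends G e))) ×
  (∀ f → ends H f ≡ mapPair (merge _ _ d) (ends G (punchIn e f))
       × pos H f ≡ pos G (punchIn e f)) } }

data OneStep (G H : SGraph) : Set where
  del : (e : Fin (m G)) → delete G e H → OneStep G H
  con : (e : Fin (m G)) → contract G e H → OneStep G H

data StrongMinor (G : SGraph) : SGraph → Set where
  done : StrongMinor G G
  more : ∀ {H K} → StrongMinor G H → OneStep H K → StrongMinor G K

Iso : SGraph → SGraph → Set
Iso G H = Σ (Fin (n G) ↔ Fin (n H)) λ φ → Σ (Fin (m G) ↔ Fin (m H)) λ ψ →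
  ∀ e → pos H (Inverse.to ψ e) ≡ pos G e ×
        Joins H (Inverse.to ψ e) (Inverse.to φ (proj₁ (ends G e)))
                                 (Inverse.to φ (proj₂ (ends G e)))

-- Flow-star on v₀ = zero, v_i = suc (i-1) (i = 1..k).  Edges Fin (k + k):
-- the first k are positive v₀v_i, the last k are negative v_i v_{i+1 mod k}.

flowStar : ℕ → SGraph
flowStar k = record
  { n = suc k ; m = k + k ; ends = en ; pos = sg }
  where
  en : Fin (k + k) → Fin (suc k) × Fin (suc k)
  en x with splitAt k x
  ... | inj₁ i = zero , suc i
  ... | inj₂ i = suc i , suc (csuc i)
  sg : Fin (k + k) → Bool
  sg x with splitAt k x
  ... | inj₁ _ = true
  ... | inj₂ _ = false

HasOddFlowStarStrongMinor : SGraph → Set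
HasOddFlowStarStrongMinor G =
  Σ ℕ λ k → 3 ≤ k × k % 2 ≡ 1 ×
  Σ SGraph λ H → StrongMinor G H × Iso H (flowStar k)

-- Let the flows r i and the edges c i (i < k, k odd) form an odd 2-circulant submatrix.
-- Flow r i is its negative edge f i closed up by the tree path between the ends of f i, and
-- this path contains c i and c (i+1) but no other column. Tree paths are unique, so distinct
-- rows have distinct negative edges, and no column is negative. Delete the negative edges
-- other than the f i and contract the positive edges other than the c i: acyclicity of the
-- tree keeps every contraction loop-free. In the resulting minor the path of f i consists of
-- the two spokes c i and c (i+1) at a common centre, and the minor is the flow-star on k spokes.

module Submission where

open import Defs

open import Data.Nat as ℕ using (ℕ; zero; suc; _+_; _≤_; _<_; z≤n; s≤s)
open import Data.Nat.Properties as ℕP using (≤-refl; ≤-trans; +-comm; +-assoc; +-identityʳ; suc-injective)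
open import Data.Nat.DivMod using (_%_; m%n<n; n%n≡0; m<n⇒m%n≡m)
open import Data.Fin as F using (Fin; zero; suc; toℕ; fromℕ<; punchIn; punchOut; splitAt; _≟_)
open import Data.Fin.Properties as FP using (toℕ-injective; toℕ-fromℕ<; toℕ<n)
open import Data.Bool as B using (Bool; true; false)
open import Data.Maybe using (Maybe; just; nothing)
open import Data.Maybe.Properties using (just-injective; ≡-dec)
open import Data.Product using (Σ; ∃-syntax; _×_; _,_; proj₁; proj₂)
open import Data.Product.Properties using (,-injectiveˡ; ,-injectiveʳ)
open import Data.Sum using (_⊎_; inj₁; inj₂; [_,_]′)
open import Data.Unit using (⊤; tt)
open import Data.Empty using (⊥; ⊥-elim)
open import Function using (_∘_)
open import Function.Bundles using (_↔_; Inverse; mk↔ₛ′)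
open import Relation.Nullary using (¬_; Dec; yes; no; contradiction)
open import Relation.Nullary.Decidable using (¬?; _×-dec_; _⊎-dec_; decidable-stable)
open import Relation.Binary.PropositionalEquality using (_≡_; _≢_; refl; sym; trans; cong; cong₂; subst; module ≡-Reasoning)

toℕ-csuc-< : ∀ {l} (i : Fin (suc l)) → toℕ i < l → toℕ (csuc i) ≡ suc (toℕ i)
toℕ-csuc-< {l} i lt = trans (toℕ-fromℕ< (m%n<n (suc (toℕ i)) (suc l))) (m<n⇒m%n≡m (s≤s lt))

toℕ-csuc-last : ∀ {l} (i : Fin (suc l)) → toℕ i ≡ l → toℕ (csuc i) ≡ 0
toℕ-csuc-last {l} i eq = trans (toℕ-fromℕ< (m%n<n (suc (toℕ i)) (suc l)))
  (trans (cong (λ z → suc z % suc l) eq) (n%n≡0 (suc l)))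

last-or-< : ∀ {l} (i : Fin (suc l)) → toℕ i < l ⊎ toℕ i ≡ l
last-or-< i = ℕP.m≤n⇒m<n∨m≡n (ℕ.s≤s⁻¹ (toℕ<n i))

csuc-injective : ∀ {l} (i j : Fin (suc l)) → csuc i ≡ csuc j → i ≡ j
csuc-injective i j eq with last-or-< i | last-or-< j
... | inj₁ a | inj₁ b = toℕ-injective (suc-injective
  (trans (sym (toℕ-csuc-< i a)) (trans (cong toℕ eq) (toℕ-csuc-< j b))))
... | inj₂ a | inj₂ b = toℕ-injective (trans a (sym b))
... | inj₁ a | inj₂ b with () ← trans (sym (toℕ-csuc-< i a)) (trans (cong toℕ eq) (toℕ-csuc-last j b))
... | inj₂ a | inj₁ b with () ← trans (sym (toℕ-csuc-< j b)) (trans (cong toℕ (sym eq)) (toℕ-csuc-last i a))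

csuc-≢ : ∀ {l} (i : Fin (suc (suc l))) → csuc i ≢ i
csuc-≢ i eq with last-or-< i
... | inj₁ a = ℕP.<-irrefl (trans (sym (cong toℕ eq)) (toℕ-csuc-< i a)) (ℕP.n<1+n _)
... | inj₂ a with () ← trans (sym (toℕ-csuc-last i a)) (trans (cong toℕ eq) a)

csuc²-≢ : ∀ {l} (i : Fin (suc (suc (suc l)))) → csuc (csuc i) ≢ i
csuc²-≢ {l} i eq with last-or-< i
... | inj₂ a with () ← trans (sym (trans (toℕ-csuc-< (csuc i) (subst (_< suc (suc l)) (sym (toℕ-csuc-last i a)) (s≤s z≤n)))
                                        (cong suc (toℕ-csuc-last i a))))
                             (trans (cong toℕ eq) a)
... | inj₁ a with last-or-< (csuc i)
...   | inj₁ b = ℕP.<-irrefl (trans (sym (cong toℕ eq)) (trans (toℕ-csuc-< (csuc i) b) (cong suc (toℕ-csuc-< i a))))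
                             (ℕP.≤-trans (ℕP.n<1+n _) (ℕP.n≤1+n _))
...   | inj₂ b with () ← trans (cong suc (trans (sym (toℕ-csuc-last (csuc i) b)) (cong toℕ eq)))
                               (trans (sym (toℕ-csuc-< i a)) b)

csuc-surjective : ∀ {l} (j : Fin (suc l)) → ∃[ i ] csuc i ≡ j
csuc-surjective {l} zero = fromℕ< (ℕP.n<1+n l) , toℕ-injective (toℕ-csuc-last _ (toℕ-fromℕ< (ℕP.n<1+n l)))
csuc-surjective {suc l} (suc j) = F.inject₁ j ,
  toℕ-injective (trans (toℕ-csuc-< (F.inject₁ j) (subst (_< suc l) (sym (FP.toℕ-inject₁ j)) (toℕ<n j)))
                       (cong suc (FP.toℕ-inject₁ j)))

pred< : ∀ {l j} → suc j < suc l → j < suc l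
pred< p = ℕP.<-trans (ℕP.n<1+n _) p

csuc-fromℕ< : ∀ {l} j (p : suc j < suc l) → csuc (fromℕ< (pred< p)) ≡ fromℕ< p
csuc-fromℕ< {l} j p = toℕ-injective (trans (toℕ-csuc-< (fromℕ< (pred< p))
                        (subst (_< l) (sym (toℕ-fromℕ< (pred< p))) (ℕ.s<s⁻¹ p)))
                        (trans (cong suc (toℕ-fromℕ< (pred< p))) (sym (toℕ-fromℕ< p))))

csuc-invariant : ∀ {l} {A : Set} (g : Fin (suc l) → A) → (∀ i → g i ≡ g (csuc i)) → ∀ i → g i ≡ g zero
csuc-invariant {l} g invariant i = trans (cong g (sym (FP.fromℕ<-toℕ i (toℕ<n i)))) (reach (toℕ i) (toℕ<n i))
  where
  reach : ∀ j (p : j < suc l) → g (fromℕ< p) ≡ g zero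
  reach zero p = refl
  reach (suc j) p = trans (cong g (sym (csuc-fromℕ< j p))) (trans (sym (invariant _)) (reach j (pred< p)))

δ : ∀ {k} → Fin k → Fin k → ℕ
δ a b with a ≟ b
... | yes _ = 1
... | no _ = 0

δ-refl : ∀ {k} (a : Fin k) → δ a a ≡ 1
δ-refl a with a ≟ a
... | yes _ = refl
... | no a≢a = contradiction refl a≢a

δ-≢ : ∀ {k} {a b : Fin k} → a ≢ b → δ a b ≡ 0
δ-≢ {a = a} {b} a≢b with a ≟ b
... | yes a≡b = contradiction a≡b a≢b
... | no _ = refl

δ>0⇒≡ : ∀ {k} {a b : Fin k} → 0 < δ a b → a ≡ b
δ>0⇒≡ {a = a} {b} p with a ≟ b
... | yes a≡b = a≡b

δ-cong : ∀ {k k'} {a b : Fin k} {c d : Fin k'} → (a ≡ b → c ≡ d) → (c ≡ d → a ≡ b) → δ a b ≡ δ c d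
δ-cong {a = a} {b} {c} {d} to from with a ≟ b | c ≟ d
... | yes _ | yes _ = refl
... | yes p | no q = contradiction (to p) q
... | no p | yes q = contradiction (from q) p
... | no _ | no _ = refl

Positive : (G : SGraph) → Fin (m G) → Set
Positive G e = pos G e ≡ true

positive≢negative : ∀ {G : SGraph} {e e'} → pos G e ≡ true → pos G e' ≡ false → e ≢ e'
positive≢negative p q refl with () ← trans (sym p) q

data Walk (G : SGraph) : Fin (n G) → Fin (n G) → Set where
  [] : ∀ {u} → Walk G u u
  step : ∀ {u w v} (e : Fin (m G)) → Joins G e u w → Walk G w v → Walk G u v

module _ {G : SGraph} where

  Joins-sym : ∀ {e a b} → Joins G e a b → Joins G e b a
  Joins-sym (inj₁ x) = inj₂ x
  Joins-sym (inj₂ y) = inj₁ y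

  Joins-cast : ∀ {e e' a a' b b'} → e ≡ e' → a ≡ a' → b ≡ b' → Joins G e a b → Joins G e' a' b'
  Joins-cast refl refl refl j = j

  Joins-unique : ∀ {e x y x' y'} → Joins G e x y → Joins G e x' y' → (x ≡ x' × y ≡ y') ⊎ (x ≡ y' × y ≡ x')
  Joins-unique (inj₁ p) (inj₁ q) = inj₁ (,-injectiveˡ (trans (sym p) q) , ,-injectiveʳ (trans (sym p) q))
  Joins-unique (inj₁ p) (inj₂ q) = inj₂ (,-injectiveˡ (trans (sym p) q) , ,-injectiveʳ (trans (sym p) q))
  Joins-unique (inj₂ p) (inj₁ q) = inj₂ (,-injectiveʳ (trans (sym p) q) , ,-injectiveˡ (trans (sym p) q))
  Joins-unique (inj₂ p) (inj₂ q) = inj₁ (,-injectiveʳ (trans (sym p) q) , ,-injectiveˡ (trans (sym p) q))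

  Joins-end : ∀ {e a w x y} → Joins G e a w → Joins G e x y → a ≡ x ⊎ a ≡ y
  Joins-end j j' with Joins-unique j j'
  ... | inj₁ (a≡x , _) = inj₁ a≡x
  ... | inj₂ (a≡y , _) = inj₂ a≡y

  Joins-other : ∀ {e c x y} → Joins G e c x → Joins G e y c → x ≡ y
  Joins-other j j' with Joins-unique j j'
  ... | inj₁ (c≡y , x≡c) = trans x≡c c≡y
  ... | inj₂ (_ , x≡y) = x≡y

  infixr 5 _++_
  _++_ : ∀ {u v w} → Walk G u v → Walk G v w → Walk G u w
  [] ++ W = W
  step e j W ++ W' = step e j (W ++ W')

  reverse : ∀ {u v} → Walk G u v → Walk G v u
  reverse [] = []
  reverse (step e j W) = reverse W ++ step e (Joins-sym j) []

  cast : ∀ {a a' b b'} → a ≡ a' → b ≡ b' → Walk G a b → Walk G a' b'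
  cast refl refl W = W

  count : ∀ {u v} → Fin (m G) → Walk G u v → ℕ
  count e [] = 0
  count e (step e' _ W) = δ e e' + count e W

  _∈ₑ_ : ∀ {u v} → Fin (m G) → Walk G u v → Set
  e ∈ₑ W = 0 < count e W

  count-++ : ∀ {u v w} e (W : Walk G u v) (W' : Walk G v w) → count e (W ++ W') ≡ count e W + count e W'
  count-++ e [] W' = refl
  count-++ e (step e' j W) W' = trans (cong (δ e e' +_) (count-++ e W W')) (sym (+-assoc (δ e e') _ _))

  count-reverse : ∀ {u v} e (W : Walk G u v) → count e (reverse W) ≡ count e W
  count-reverse e [] = refl
  count-reverse e (step e' j W) = trans (count-++ e (reverse W) _)
    (trans (cong₂ _+_ (count-reverse e W) (+-identityʳ (δ e e'))) (+-comm (count e W) _))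

  count-cast : ∀ {a a' b b'} x (p : a ≡ a') (q : b ≡ b') (W : Walk G a b) → count x (cast p q W) ≡ count x W
  count-cast x refl refl W = refl

  count-head : ∀ {u w v} e (j : Joins G e u w) (W : Walk G w v) → e ∈ₑ step e j W
  count-head e j W = subst (λ z → 0 < z + count e W) (sym (δ-refl e)) (s≤s z≤n)

  count-tail : ∀ {u w v} e e' (j : Joins G e' u w) (W : Walk G w v) → count e W ≤ count e (step e' j W)
  count-tail e e' j W = ℕP.m≤n+m (count e W) (δ e e')

  All : ∀ {u v} → (Fin (m G) → Set) → Walk G u v → Set
  All Q [] = ⊤
  All Q (step e _ W) = Q e × All Q W

  AllPos : ∀ {u v} → Walk G u v → Set
  AllPos = All (Positive G)

  module _ {Q : Fin (m G) → Set} where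

    All-++ : ∀ {a b c} (W : Walk G a b) (W' : Walk G b c) → All Q W → All Q W' → All Q (W ++ W')
    All-++ [] W' _ h = h
    All-++ (step e j W) W' (q , h) h' = q , All-++ W W' h h'

    All-++ˡ : ∀ {a b c} (W : Walk G a b) (W' : Walk G b c) → All Q (W ++ W') → All Q W
    All-++ˡ [] W' _ = tt
    All-++ˡ (step e j W) W' (q , h) = q , All-++ˡ W W' h

    All-++ʳ : ∀ {a b c} (W : Walk G a b) (W' : Walk G b c) → All Q (W ++ W') → All Q W'
    All-++ʳ [] W' h = h
    All-++ʳ (step e j W) W' (q , h) = All-++ʳ W W' h

    All-reverse : ∀ {a b} (W : Walk G a b) → All Q W → All Q (reverse W)
    All-reverse [] _ = tt
    All-reverse (step e j W) (q , h) = All-++ (reverse W) _ (All-reverse W h) (q , tt)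

    All-cast : ∀ {a a' b b'} (p : a ≡ a') (q : b ≡ b') (W : Walk G a b) → All Q W → All Q (cast p q W)
    All-cast refl refl W h = h

    All-∈ : ∀ {a b} (W : Walk G a b) → All Q W → ∀ e → e ∈ₑ W → Q e
    All-∈ (step e' j W) (q , h) e e∈W with e ≟ e'
    ... | yes refl = q
    ... | no _ = All-∈ W h e e∈W

    ∈-All : ∀ {a b} (W : Walk G a b) → (∀ e → e ∈ₑ W → Q e) → All Q W
    ∈-All [] _ = tt
    ∈-All (step e j W) h = h e (count-head e j W) , ∈-All W (λ e' e'∈W → h e' (≤-trans e'∈W (count-tail e' e j W)))

    All-∉ : ∀ {a b} (W : Walk G a b) → All Q W → ∀ e → ¬ Q e → count e W ≡ 0
    All-∉ W h e ¬q = ℕP.n≤0⇒n≡0 (ℕP.≮⇒≥ λ e∈W → ¬q (All-∈ W h e e∈W))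

  All-map : ∀ {a b} {Q Q' : Fin (m G) → Set} → (∀ e → Q e → Q' e) → (W : Walk G a b) → All Q W → All Q' W
  All-map g [] _ = tt
  All-map g (step e j W) (q , h) = g e q , All-map g W h

  split-once : ∀ {a b} e (W : Walk G a b) → count e W ≡ 1 →
    Σ (Fin (n G)) λ x → Σ (Fin (n G)) λ y → Σ (Joins G e x y) λ j →
    Σ (Walk G a x) λ W₁ → Σ (Walk G y b) λ W₂ →
    count e W₁ ≡ 0 × count e W₂ ≡ 0 × W ≡ W₁ ++ step e j W₂
  split-once e (step {u} {w} e' j W) c with e ≟ e'
  ... | yes refl = u , w , j , [] , W , refl , suc-injective c , refl
  ... | no e≢e' with split-once e W c
  ...   | x , y , j' , W₁ , W₂ , c₁ , c₂ , eq =
          x , y , j' , step e' j W₁ , W₂ , trans (cong (_+ count e W₁) (δ-≢ e≢e')) c₁ , c₂ , cong (step e' j) eq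

  _∈ᵥ_ : ∀ {u v} → Fin (n G) → Walk G u v → Set
  _∈ᵥ_ {u} x [] = x ≡ u
  x ∈ᵥ step {u} e _ W = x ≡ u ⊎ x ∈ᵥ W

  _∈ᵥ?_ : ∀ {u v} x (W : Walk G u v) → Dec (x ∈ᵥ W)
  _∈ᵥ?_ {u} x [] = x ≟ u
  x ∈ᵥ? step {u} e _ W with x ≟ u | x ∈ᵥ? W
  ... | yes p | _ = yes (inj₁ p)
  ... | no _ | yes q = yes (inj₂ q)
  ... | no ¬p | no ¬q = no λ { (inj₁ p) → ¬p p ; (inj₂ q) → ¬q q }

  start-∈ᵥ : ∀ {a b} (W : Walk G a b) → a ∈ᵥ W
  start-∈ᵥ [] = refl
  start-∈ᵥ (step e j W) = inj₁ refl

  ∈ₑ⇒ends-∈ᵥ : ∀ {a b} e (W : Walk G a b) → e ∈ₑ W →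
    Σ (Fin (n G)) λ x → Σ (Fin (n G)) λ y → Joins G e x y × x ∈ᵥ W × y ∈ᵥ W
  ∈ₑ⇒ends-∈ᵥ e (step {u} {w} e' j W) e∈W with e ≟ e'
  ... | yes refl = u , w , j , inj₁ refl , inj₂ (start-∈ᵥ W)
  ... | no _ with ∈ₑ⇒ends-∈ᵥ e W e∈W
  ...   | x , y , j' , x∈W , y∈W = x , y , j' , inj₂ x∈W , inj₂ y∈W

  Simple : ∀ {u v} → Walk G u v → Set
  Simple [] = ⊤
  Simple (step {u} e _ W) = ¬ u ∈ᵥ W × count e W ≡ 0 × Simple W

  Sub : ∀ {a b a' b'} → Walk G a b → Walk G a' b' → Set
  Sub W W' = ∀ e → count e W ≤ count e W'

  suffix-from : ∀ {a b} x (W : Walk G a b) → x ∈ᵥ W →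
    Σ (Walk G x b) λ S → (Simple W → Simple S) × Sub S W
  suffix-from x [] refl = [] , (λ s → s) , λ _ → ≤-refl
  suffix-from x (step e j W) (inj₁ refl) = step e j W , (λ s → s) , λ _ → ≤-refl
  suffix-from x (step e' j W) (inj₂ x∈W) with suffix-from x W x∈W
  ... | S , simple , sub = S , (λ s → simple (proj₂ (proj₂ s))) , λ e → ≤-trans (sub e) (count-tail e e' j W)

  simplify : ∀ {a b} (W : Walk G a b) → Σ (Walk G a b) λ S → Simple S × Sub S W
  simplify [] = [] , tt , λ _ → ≤-refl
  simplify (step {a} e j W) with simplify W
  ... | S , simple , sub with a ∈ᵥ? S
  ...   | yes a∈S = let (S' , simple' , sub') = suffix-from a S a∈S in
                    S' , simple' simple , λ e' → ≤-trans (sub' e') (≤-trans (sub e') (count-tail e' e j W))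
  ...   | no a∉S = step e j S , (a∉S , e∉S , simple) , λ e' → ℕP.+-monoʳ-≤ (δ e' e) (sub e')
    where
    e∉S : count e S ≡ 0
    e∉S = ℕP.n≤0⇒n≡0 (ℕP.≮⇒≥ λ e∈S → let (x , y , j' , x∈S , y∈S) = ∈ₑ⇒ends-∈ᵥ e S e∈S in
            [ (λ a≡x → a∉S (subst (_∈ᵥ S) (sym a≡x) x∈S)) , (λ a≡y → a∉S (subst (_∈ᵥ S) (sym a≡y) y∈S)) ]′
              (Joins-end j j'))

  length : ∀ {u v} → Walk G u v → ℕ
  length [] = 0
  length (step _ _ W) = suc (length W)

  vertexAt : ∀ {a b} → ℕ → Walk G a b → Fin (n G)
  vertexAt {a} zero W = a
  vertexAt {a} (suc i) [] = a
  vertexAt (suc i) (step e j W) = vertexAt i W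

  -- the default d is returned past the end of the walk
  edgeAt : ∀ {a b} → ℕ → Walk G a b → Fin (m G) → Fin (m G)
  edgeAt i [] d = d
  edgeAt zero (step e j W) d = e
  edgeAt (suc i) (step e j W) d = edgeAt i W d

  vertexAt-length : ∀ {a b} (W : Walk G a b) → vertexAt (length W) W ≡ b
  vertexAt-length [] = refl
  vertexAt-length (step e j W) = vertexAt-length W

  edgeAt-length : ∀ {a b} (W : Walk G a b) d → edgeAt (length W) W d ≡ d
  edgeAt-length [] d = refl
  edgeAt-length (step e j W) d = edgeAt-length W d

  vertexAt-∈ᵥ : ∀ {a b} i (W : Walk G a b) → i ≤ length W → vertexAt i W ∈ᵥ W
  vertexAt-∈ᵥ zero W _ = start-∈ᵥ W
  vertexAt-∈ᵥ (suc i) (step e j W) (s≤s i≤) = inj₂ (vertexAt-∈ᵥ i W i≤)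

  edgeAt-∈ₑ : ∀ {a b} i (W : Walk G a b) d → i < length W → edgeAt i W d ∈ₑ W
  edgeAt-∈ₑ zero (step e j W) d _ = count-head e j W
  edgeAt-∈ₑ (suc i) (step e j W) d (s≤s i<) = ≤-trans (edgeAt-∈ₑ i W d i<) (count-tail _ e j W)

  edgeAt-joins : ∀ {a b} i (W : Walk G a b) d → i < length W →
                 Joins G (edgeAt i W d) (vertexAt i W) (vertexAt (suc i) W)
  edgeAt-joins zero (step e j W) d _ = j
  edgeAt-joins (suc i) (step e j W) d (s≤s i<) = edgeAt-joins i W d i<

  vertexAt-injective : ∀ {a b} (W : Walk G a b) → Simple W → ∀ i k → i ≤ length W → k ≤ length W →
                       vertexAt i W ≡ vertexAt k W → i ≡ k
  vertexAt-injective W _ zero zero _ _ _ = refl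
  vertexAt-injective (step e j W) (a∉W , _) zero (suc k) _ (s≤s k≤) eq =
    contradiction (subst (_∈ᵥ W) (sym eq) (vertexAt-∈ᵥ k W k≤)) a∉W
  vertexAt-injective (step e j W) (a∉W , _) (suc i) zero (s≤s i≤) _ eq =
    contradiction (subst (_∈ᵥ W) eq (vertexAt-∈ᵥ i W i≤)) a∉W
  vertexAt-injective (step e j W) (_ , _ , simple) (suc i) (suc k) (s≤s i≤) (s≤s k≤) eq =
    cong suc (vertexAt-injective W simple i k i≤ k≤ eq)

  edgeAt-injective : ∀ {a b} (W : Walk G a b) d → Simple W → ∀ i k → i < length W → k < length W →
                     edgeAt i W d ≡ edgeAt k W d → i ≡ k
  edgeAt-injective W d _ zero zero _ _ _ = refl
  edgeAt-injective (step e j W) d (_ , e∉W , _) zero (suc k) _ (s≤s k<) eq =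
    ⊥-elim (ℕP.<-irrefl (sym e∉W) (subst (_∈ₑ W) (sym eq) (edgeAt-∈ₑ k W d k<)))
  edgeAt-injective (step e j W) d (_ , e∉W , _) (suc i) zero (s≤s i<) _ eq =
    ⊥-elim (ℕP.<-irrefl (sym e∉W) (subst (_∈ₑ W) eq (edgeAt-∈ₑ i W d i<)))
  edgeAt-injective (step e j W) d (_ , _ , simple) (suc i) (suc k) (s≤s i<) (s≤s k<) eq =
    cong suc (edgeAt-injective W d simple i k i< k< eq)

  close-positive-path : ∀ {x y} e (S : Walk G y x) → Simple S → AllPos S → count e S ≡ 0 → pos G e ≡ true →
    Joins G e x y → Σ (Circuit G) λ C → ∀ i → pos G (edg C i) ≡ true
  close-positive-path {x} {y} e S simple positive e∉S pe je = C , C-positive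
    where
    L = length S
    index≤ : (i : Fin (suc L)) → toℕ i ≤ L
    index≤ i = ℕ.s≤s⁻¹ (toℕ<n i)
    edgeAt-last : ∀ (i : Fin (suc L)) → toℕ i ≡ L → edgeAt (toℕ i) S e ≡ e
    edgeAt-last i i≡L = trans (cong (λ z → edgeAt z S e) i≡L) (edgeAt-length S e)
    edgeAt-<≢ : ∀ (i : Fin (suc L)) → toℕ i < L → edgeAt (toℕ i) S e ≢ e
    edgeAt-<≢ i i<L eq = ℕP.<-irrefl (sym e∉S) (subst (_∈ₑ S) eq (edgeAt-∈ₑ (toℕ i) S e i<L))
    vtx-injective : Injective (λ (i : Fin (suc L)) → vertexAt (toℕ i) S)
    vtx-injective i i' eq = toℕ-injective (vertexAt-injective S simple (toℕ i) (toℕ i') (index≤ i) (index≤ i') eq)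
    edg-injective : Injective (λ (i : Fin (suc L)) → edgeAt (toℕ i) S e)
    edg-injective i i' eq with last-or-< i | last-or-< i'
    ... | inj₁ l | inj₁ l' = toℕ-injective (edgeAt-injective S e simple (toℕ i) (toℕ i') l l' eq)
    ... | inj₁ l | inj₂ p' = contradiction (trans eq (edgeAt-last i' p')) (edgeAt-<≢ i l)
    ... | inj₂ p | inj₁ l' = contradiction (trans (sym eq) (edgeAt-last i p)) (edgeAt-<≢ i' l')
    ... | inj₂ p | inj₂ p' = toℕ-injective (trans p (sym p'))
    joins' : ∀ (i : Fin (suc L)) → Joins G (edgeAt (toℕ i) S e) (vertexAt (toℕ i) S) (vertexAt (toℕ (csuc i)) S)
    joins' i with last-or-< i
    ... | inj₁ l = Joins-cast refl refl (cong (λ z → vertexAt z S) (sym (toℕ-csuc-< i l))) (edgeAt-joins (toℕ i) S e l)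
    ... | inj₂ p = Joins-cast (sym (edgeAt-last i p)) (sym (trans (cong (λ z → vertexAt z S) p) (vertexAt-length S)))
                     (cong (λ z → vertexAt z S) (sym (toℕ-csuc-last i p))) je
    C : Circuit G
    C = record { len = L ; vtx = λ i → vertexAt (toℕ i) S ; edg = λ i → edgeAt (toℕ i) S e
               ; vtx-inj = vtx-injective ; edg-inj = edg-injective ; joins = joins' }
    C-positive : ∀ i → pos G (edg C i) ≡ true
    C-positive i with last-or-< i
    ... | inj₁ l = All-∈ S positive _ (edgeAt-∈ₑ (toℕ i) S e l)
    ... | inj₂ p = subst (Positive G) (sym (edgeAt-last i p)) pe

  -- Splitting the walk at e and simplifying the rest yields a positive circuit through e.
  acyclic⇒no-closed-walk-crossing-once : PosAcyclic G → ∀ {a} e (W : Walk G a a) → AllPos W → count e W ≡ 1 → ⊥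
  acyclic⇒no-closed-walk-crossing-once acyclic e W positive once with split-once e W once
  ... | x , y , j , W₁ , W₂ , e∉W₁ , e∉W₂ , refl = acyclic (close-positive-path e S simple S-positive e∉S pe j)
    where
    pe : pos G e ≡ true
    pe = proj₁ (All-++ʳ W₁ (step e j W₂) positive)
    R = W₂ ++ W₁
    R-positive : AllPos R
    R-positive = All-++ W₂ W₁ (proj₂ (All-++ʳ W₁ (step e j W₂) positive)) (All-++ˡ W₁ (step e j W₂) positive)
    e∉R : count e R ≡ 0
    e∉R = trans (count-++ e W₂ W₁) (cong₂ _+_ e∉W₂ e∉W₁)
    S = proj₁ (simplify R)
    simple = proj₁ (proj₂ (simplify R))
    sub = proj₂ (proj₂ (simplify R))
    e∉S : count e S ≡ 0
    e∉S = ℕP.n≤0⇒n≡0 (subst (count e S ≤_) e∉R (sub e))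
    S-positive : AllPos S
    S-positive = ∈-All S (λ e' e'∈S → All-∈ R R-positive e' (≤-trans e'∈S (sub e')))

  module CyclicConcat {l : ℕ} (g : Fin (suc l) → Fin (n G)) (seg : ∀ i → Walk G (g i) (g (csuc i))) where

    seg′ : ∀ j (p : suc j < suc l) → Walk G (g (fromℕ< (pred< p))) (g (fromℕ< p))
    seg′ j p = cast refl (cong g (csuc-fromℕ< j p)) (seg (fromℕ< (pred< p)))

    count-seg′ : ∀ x j p → count x (seg′ j p) ≡ count x (seg (fromℕ< (pred< p)))
    count-seg′ x j p = count-cast x refl (cong g (csuc-fromℕ< j p)) (seg (fromℕ< (pred< p)))

    prefix : ∀ j (p : j < suc l) → Walk G (g zero) (g (fromℕ< p))
    prefix zero p = []
    prefix (suc j) p = prefix j (pred< p) ++ seg′ j p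

    lastIndex : Fin (suc l)
    lastIndex = fromℕ< (ℕP.n<1+n l)

    csuc-lastIndex : csuc lastIndex ≡ zero
    csuc-lastIndex = toℕ-injective (toℕ-csuc-last lastIndex (toℕ-fromℕ< (ℕP.n<1+n l)))

    lastSeg : Walk G (g lastIndex) (g zero)
    lastSeg = cast refl (cong g csuc-lastIndex) (seg lastIndex)

    closed : Walk G (g zero) (g zero)
    closed = prefix l (ℕP.n<1+n l) ++ lastSeg

    closed-All : ∀ {Q} → (∀ i → All Q (seg i)) → All Q closed
    closed-All {Q} h = All-++ (prefix l _) _ (prefix-All l _) (All-cast _ _ _ (h lastIndex))
      where
      prefix-All : ∀ j (p : j < suc l) → All Q (prefix j p)
      prefix-All zero p = tt
      prefix-All (suc j) p = All-++ (prefix j _) _ (prefix-All j _) (All-cast _ _ _ (h _))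

    module _ (x : Fin (m G)) (i₀ : Fin (suc l)) (elsewhere : ∀ i → i ≢ i₀ → count x (seg i) ≡ 0) where

      count-prefix : ∀ j (p : j < suc l) →
        (toℕ i₀ < j → count x (prefix j p) ≡ count x (seg i₀)) × (¬ toℕ i₀ < j → count x (prefix j p) ≡ 0)
      count-prefix zero p = (λ ()) , λ _ → refl
      count-prefix (suc j) p with count-prefix j (pred< p) | toℕ i₀ ℕP.≟ j
      ... | _ , before | yes i₀≡j = (λ _ → c) , λ i₀≮ → contradiction (s≤s (ℕP.≤-reflexive i₀≡j)) i₀≮
        where
        i₀≡ : fromℕ< (pred< p) ≡ i₀
        i₀≡ = toℕ-injective (trans (toℕ-fromℕ< (pred< p)) (sym i₀≡j))
        c : count x (prefix (suc j) p) ≡ count x (seg i₀)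
        c = trans (count-++ x (prefix j _) _)
              (cong₂ _+_ (before (ℕP.<-irrefl i₀≡j)) (trans (count-seg′ x j p) (cong (λ q → count x (seg q)) i₀≡)))
      ... | after , before | no i₀≢j = (λ i₀< → trans c (after (ℕP.≤∧≢⇒< (ℕ.s≤s⁻¹ i₀<) i₀≢j)))
                                     , λ i₀≮ → trans c (before (λ i₀< → i₀≮ (ℕP.m≤n⇒m≤1+n i₀<)))
        where
        c : count x (prefix (suc j) p) ≡ count x (prefix j (pred< p))
        c = trans (count-++ x (prefix j _) _)
              (trans (cong (count x (prefix j (pred< p)) +_)
                       (trans (count-seg′ x j p)
                              (elsewhere _ λ eq → i₀≢j (trans (cong toℕ (sym eq)) (toℕ-fromℕ< (pred< p))))))
                     (+-identityʳ _))

      count-closed : count x closed ≡ count x (seg i₀)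
      count-closed with toℕ i₀ ℕP.≟ l
      ... | yes i₀≡l = trans (count-++ x (prefix l _) _)
            (cong₂ _+_ (proj₂ (count-prefix l _) (ℕP.<-irrefl i₀≡l))
                       (trans (count-cast x refl (cong g csuc-lastIndex) (seg lastIndex))
                              (cong (λ q → count x (seg q)) (toℕ-injective (trans (toℕ-fromℕ< (ℕP.n<1+n l)) (sym i₀≡l))))))
      ... | no i₀≢l = trans (count-++ x (prefix l _) _)
            (trans (cong₂ _+_ (proj₁ (count-prefix l _) (ℕP.≤∧≢⇒< (ℕ.s≤s⁻¹ (toℕ<n i₀)) i₀≢l))
                              (trans (count-cast x refl (cong g csuc-lastIndex) (seg lastIndex))
                                     (elsewhere lastIndex λ eq → i₀≢l (trans (cong toℕ (sym eq)) (toℕ-fromℕ< (ℕP.n<1+n l))))))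
                   (+-identityʳ _))

  circuitWalk : (C : Circuit G) → Walk G (vtx C zero) (vtx C zero)
  circuitWalk C = CyclicConcat.closed (vtx C) (λ i → step (edg C i) (joins C i) [])

  count-circuitWalk-∈ : (C : Circuit G) → ∀ e → e ∈C C → count e (circuitWalk C) ≡ 1
  count-circuitWalk-∈ C e (q , refl) =
    trans (CyclicConcat.count-closed (vtx C) _ e q elsewhere) (cong (_+ 0) (δ-refl (edg C q)))
    where
    elsewhere : ∀ i → i ≢ q → count (edg C q) (step (edg C i) (joins C i) []) ≡ 0
    elsewhere i i≢q = cong (_+ 0) (δ-≢ λ eq → i≢q (edg-inj C i q (sym eq)))

  count-circuitWalk-∉ : (C : Circuit G) → ∀ e → ¬ e ∈C C → count e (circuitWalk C) ≡ 0
  count-circuitWalk-∉ C e e∉C = trans (CyclicConcat.count-closed (vtx C) _ e zero (λ i _ → absent i)) (absent zero)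
    where
    absent : ∀ i → count e (step (edg C i) (joins C i) []) ≡ 0
    absent i = cong (_+ 0) (δ-≢ λ eq → e∉C (i , sym eq))

  _∈C?_ : ∀ e (C : Circuit G) → Dec (e ∈C C)
  e ∈C? C = FP.any? (λ i → edg C i ≟ e)

  negEdge : Flow G → Fin (m G)
  negEdge (C , p , _) = edg C p

  negEdge-negative : (Fl : Flow G) → pos G (negEdge Fl) ≡ false
  negEdge-negative (C , p , neg , _) = neg

  negEdge-∈C : (Fl : Flow G) → negEdge Fl ∈C proj₁ Fl
  negEdge-∈C (C , p , _) = p , refl

  negative-∈C⇒negEdge : (Fl : Flow G) → ∀ e → e ∈C proj₁ Fl → pos G e ≡ false → e ≡ negEdge Fl
  negative-∈C⇒negEdge (C , p , _ , unique) e (q , refl) neg = cong (edg C) (unique q neg)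

  record FlowPath (Fl : Flow G) : Set where
    field
      src tgt : Fin (n G)
      neg-joins : Joins G (negEdge Fl) src tgt
      path : Walk G tgt src
      path-positive : AllPos path
      count-∈ : ∀ e → e ∈C proj₁ Fl → e ≢ negEdge Fl → count e path ≡ 1
      count-∉ : ∀ e → ¬ e ∈C proj₁ Fl → count e path ≡ 0

  flowPath : (Fl : Flow G) → FlowPath Fl
  flowPath (C , p , neg , unique) with split-once (edg C p) (circuitWalk C) (count-circuitWalk-∈ C (edg C p) (p , refl))
  ... | x , y , j , W₁ , W₂ , f∉W₁ , f∉W₂ , W≡ = record
    { src = x ; tgt = y ; neg-joins = j ; path = W₂ ++ W₁ ; path-positive = ∈-All (W₂ ++ W₁) positive
    ; count-∈ = λ e e∈C e≢f → trans (count-path e e≢f) (count-circuitWalk-∈ C e e∈C)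
    ; count-∉ = λ e e∉C → trans (count-path e (λ { refl → e∉C (p , refl) })) (count-circuitWalk-∉ C e e∉C) }
    where
    f = edg C p
    count-path : ∀ e → e ≢ f → count e (W₂ ++ W₁) ≡ count e (circuitWalk C)
    count-path e e≢f = begin
      count e (W₂ ++ W₁)                 ≡⟨ count-++ e W₂ W₁ ⟩
      count e W₂ + count e W₁            ≡⟨ +-comm (count e W₂) (count e W₁) ⟩
      count e W₁ + count e W₂            ≡⟨ cong (λ z → count e W₁ + (z + count e W₂)) (sym (δ-≢ e≢f)) ⟩
      count e W₁ + count e (step f j W₂) ≡⟨ sym (count-++ e W₁ (step f j W₂)) ⟩
      count e (W₁ ++ step f j W₂)        ≡⟨ cong (count e) (sym W≡) ⟩
      count e (circuitWalk C)            ∎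
      where open ≡-Reasoning
    positive : ∀ e → e ∈ₑ (W₂ ++ W₁) → pos G e ≡ true
    positive e e∈P with e ≟ f
    ... | yes refl = ⊥-elim (ℕP.<-irrefl (sym (trans (count-++ f W₂ W₁) (cong₂ _+_ f∉W₂ f∉W₁))) e∈P)
    ... | no e≢f with e ∈C? C
    ...   | no e∉C = ⊥-elim (ℕP.<-irrefl (sym (trans (count-path e e≢f) (count-circuitWalk-∉ C e e∉C))) e∈P)
    ...   | yes (q , refl) with pos G (edg C q) in pe
    ...     | true = refl
    ...     | false = contradiction (cong (edg C) (unique q pe)) e≢f

  -- Both flows close the same negative edge by positive paths, so an edge on one path only
  -- would be crossed once by a positive closed walk.
  same-negEdge⇒⊆ : PosAcyclic G → (Fl Fl' : Flow G) → negEdge Fl ≡ negEdge Fl' →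
                   ∀ t → t ∈C proj₁ Fl → t ∈C proj₁ Fl'
  same-negEdge⇒⊆ acyclic Fl Fl' same t t∈ with t ∈C? proj₁ Fl'
  ... | yes t∈' = t∈'
  ... | no t∉' = ⊥-elim (acyclic⇒no-closed-walk-crossing-once acyclic t (P.path ++ B)
                   (All-++ P.path B P.path-positive B-positive)
                   (trans (count-++ t P.path B) (cong₂ _+_ (P.count-∈ t t∈ t≢f) t∉B)))
    where
    module P = FlowPath (flowPath Fl)
    module P' = FlowPath (flowPath Fl')
    t≢f : t ≢ negEdge Fl
    t≢f t≡f = t∉' (subst (_∈C proj₁ Fl') (sym (trans t≡f same)) (negEdge-∈C Fl'))
    back : Σ (Walk G P.src P.tgt) λ B → AllPos B × count t B ≡ 0
    back with Joins-unique P.neg-joins (subst (λ z → Joins G z P'.src P'.tgt) (sym same) P'.neg-joins)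
    ... | inj₁ (x≡ , y≡) = cast (sym x≡) (sym y≡) (reverse P'.path)
                         , All-cast _ _ _ (All-reverse P'.path P'.path-positive)
                         , trans (count-cast t (sym x≡) (sym y≡) (reverse P'.path)) (trans (count-reverse t P'.path) (P'.count-∉ t t∉'))
    ... | inj₂ (x≡ , y≡) = cast (sym x≡) (sym y≡) P'.path , All-cast _ _ _ P'.path-positive
                         , trans (count-cast t (sym x≡) (sym y≡) P'.path) (P'.count-∉ t t∉')
    B = proj₁ back
    B-positive = proj₁ (proj₂ back)
    t∉B = proj₂ (proj₂ back)

  count≡0⇒≡ : ∀ {a b} (W : Walk G a b) → (∀ z → count z W ≡ 0) → a ≡ b
  count≡0⇒≡ [] _ = refl
  count≡0⇒≡ (step z j W) none with () ← trans (cong (_+ count z W) (sym (δ-refl z))) (none z)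

  count≡δ⇒Joins : ∀ {a b} (W : Walk G a b) B → (∀ z → count z W ≡ δ z B) → Joins G B a b
  count≡δ⇒Joins [] B once with () ← trans (once B) (δ-refl B)
  count≡δ⇒Joins (step z j W) B once with δ>0⇒≡ {a = z} {b = B} (subst (0 <_) (once z) (count-head z j W))
  ... | refl = Joins-cast refl refl (count≡0⇒≡ W λ z' → ℕP.+-cancelˡ-≡ (δ z' z) _ _ (trans (once z') (sym (+-identityʳ _)))) j

  count≡δ+δ⇒two-steps : ∀ {a b} (W : Walk G a b) A B → A ≢ B → (∀ z → count z W ≡ δ z A + δ z B) →
    Σ (Fin (n G)) λ mid → (Joins G A a mid × Joins G B mid b) ⊎ (Joins G B a mid × Joins G A mid b)
  count≡δ+δ⇒two-steps [] A B _ once with () ← trans (once A) (cong (_+ δ A B) (δ-refl A))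
  count≡δ+δ⇒two-steps (step {a} {w} z j W) A B A≢B once with z ≟ A
  ... | yes refl = w , inj₁ (j , count≡δ⇒Joins W B λ z' → ℕP.+-cancelˡ-≡ (δ z' z) _ _ (once z'))
  ... | no z≢A with δ>0⇒≡ {a = z} {b = B} (subst (0 <_) (trans (once z) (cong (_+ δ z B) (δ-≢ z≢A))) (count-head z j W))
  ...   | refl = w , inj₂ (j , count≡δ⇒Joins W A λ z' → ℕP.+-cancelˡ-≡ (δ z' z) _ _ (trans (once z') (+-comm (δ z' A) _)))

  PosWalk⇒Walk : ∀ {u v} → PosWalk G u v → Σ (Walk G u v) AllPos
  PosWalk⇒Walk here = [] , tt
  PosWalk⇒Walk (step e pe j W) = let (W' , positive) = PosWalk⇒Walk W in step e j W' , pe , positive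

-- What an odd 2-circulant submatrix leaves in the flow-star minor: t are the columns, and
-- path i is the flow of row i without its negative edge f i.
record StarPattern (G : SGraph) (K : ℕ) : Set where
  field
    t f : Fin K → Fin (m G)
    t-positive : ∀ j → pos G (t j) ≡ true
    f-negative : ∀ i → pos G (f i) ≡ false
    t-injective : Injective t
    f-injective : Injective f
    src tgt : Fin K → Fin (n G)
    f-joins : ∀ i → Joins G (f i) (src i) (tgt i)
    path : ∀ i → Walk G (tgt i) (src i)
    path-positive : ∀ i → AllPos (path i)
    count-t-path : ∀ i j → count (t j) (path i) ≡ δ j i + δ j (csuc i)

module Submatrix (G : SGraph) (acyclic : PosAcyclic G) {l : ℕ}
  (r : Fin (suc (suc (suc l))) → Flow G) (c : Fin (suc (suc (suc l))) → Fin (m G)) (c-injective : Injective c)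
  (rel : ∀ i j → (c j ∈C proj₁ (r i) → (j ≡ i ⊎ j ≡ csuc i)) × ((j ≡ i ⊎ j ≡ csuc i) → c j ∈C proj₁ (r i))) where

  K : ℕ
  K = suc (suc (suc l))

  f : Fin K → Fin (m G)
  f i = negEdge (r i)

  same-f⇒columns⊆ : ∀ {i j} → f i ≡ f j → ∀ k → k ≡ i ⊎ k ≡ csuc i → k ≡ j ⊎ k ≡ csuc j
  same-f⇒columns⊆ {i} {j} same k h = proj₁ (rel j k) (same-negEdge⇒⊆ acyclic (r i) (r j) same (c k) (proj₂ (rel i k) h))

  -- Row j would contain the columns i and csuc i, which since K ≥ 3 forces i = j.
  f-injective : Injective f
  f-injective i j same with i ≟ j
  ... | yes i≡j = i≡j
  ... | no i≢j with same-f⇒columns⊆ same i (inj₁ refl) | same-f⇒columns⊆ same (csuc i) (inj₂ refl)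
  ...   | inj₁ i≡j | _ = contradiction i≡j i≢j
  ...   | inj₂ i≡csuc-j | inj₁ csuc-i≡j = contradiction (trans (cong csuc (sym i≡csuc-j)) csuc-i≡j) (csuc²-≢ j)
  ...   | inj₂ _ | inj₂ csuc-i≡csuc-j = contradiction (csuc-injective i j csuc-i≡csuc-j) i≢j

  -- A negative column would be the negative edge of both rows containing it.
  c-positive : ∀ j → pos G (c j) ≡ true
  c-positive j with pos G (c j) in neg
  ... | true = refl
  ... | false = contradiction (trans (cong csuc (sym i≡j)) csuc-i≡j) (csuc-≢ j)
    where
    i = proj₁ (csuc-surjective j)
    csuc-i≡j = proj₂ (csuc-surjective j)
    i≡j : i ≡ j
    i≡j = f-injective i j (trans (sym (negative-∈C⇒negEdge (r i) (c j) (proj₂ (rel i j) (inj₂ (sym csuc-i≡j))) neg))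
                               (negative-∈C⇒negEdge (r j) (c j) (proj₂ (rel j j) (inj₁ refl)) neg))

  module Row (i : Fin K) = FlowPath (flowPath (r i))

  count-c-path : ∀ i j → count (c j) (Row.path i) ≡ δ j i + δ j (csuc i)
  count-c-path i j = by-cases (j ≟ i) (j ≟ csuc i)
    where
    in-row : j ≡ i ⊎ j ≡ csuc i → count (c j) (Row.path i) ≡ 1
    in-row h = Row.count-∈ i (c j) (proj₂ (rel i j) h) (positive≢negative {G = G} (c-positive j) (negEdge-negative (r i)))
    by-cases : Dec (j ≡ i) → Dec (j ≡ csuc i) → count (c j) (Row.path i) ≡ δ j i + δ j (csuc i)
    by-cases (yes refl) _ = trans (in-row (inj₁ refl)) (cong₂ _+_ (sym (δ-refl j)) (sym (δ-≢ λ e → csuc-≢ j (sym e))))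
    by-cases (no j≢i) (yes refl) = trans (in-row (inj₂ refl)) (cong₂ _+_ (sym (δ-≢ j≢i)) (sym (δ-refl j)))
    by-cases (no j≢i) (no j≢csuc-i) = trans (Row.count-∉ i (c j) (λ c∈ → [ j≢i , j≢csuc-i ]′ (proj₁ (rel i j) c∈)))
                                            (sym (cong₂ _+_ (δ-≢ j≢i) (δ-≢ j≢csuc-i)))

  starPattern : StarPattern G K
  starPattern = record
    { t = c ; f = f ; t-positive = c-positive ; f-negative = λ i → negEdge-negative (r i)
    ; t-injective = c-injective ; f-injective = f-injective
    ; src = Row.src ; tgt = Row.tgt ; f-joins = Row.neg-joins ; path = Row.path ; path-positive = Row.path-positive
    ; count-t-path = count-c-path }

merge-identifies : ∀ {k} (u v : Fin (suc k)) (u≢v : u ≢ v) → merge u v u≢v u ≡ merge u v u≢v v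
merge-identifies u v u≢v with u ≟ v | v ≟ v
... | yes u≡v | _ = contradiction u≡v u≢v
... | no _ | no v≢v = contradiction refl v≢v
... | no _ | yes _ = FP.punchOut-cong v refl

merge-punchIn : ∀ {k} (u v : Fin (suc k)) (u≢v : u ≢ v) z → merge u v u≢v (punchIn v z) ≡ z
merge-punchIn u v u≢v z with punchIn v z ≟ v
... | yes eq = contradiction eq (FP.punchInᵢ≢i v z)
... | no _ = trans (FP.punchOut-cong v refl) (FP.punchOut-punchIn v)

merge-identified : ∀ {k} (u v : Fin (suc k)) (u≢v : u ≢ v) a b → merge u v u≢v a ≡ merge u v u≢v b →
                   a ≡ b ⊎ ((a ≡ u ⊎ a ≡ v) × (b ≡ u ⊎ b ≡ v))
merge-identified u v u≢v a b eq with a ≟ v | b ≟ v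
... | yes a≡v | yes b≡v = inj₁ (trans a≡v (sym b≡v))
... | yes a≡v | no _ = inj₂ (inj₂ a≡v , inj₁ (sym (FP.punchOut-injective {i = v} _ _ eq)))
... | no _ | yes b≡v = inj₂ (inj₁ (FP.punchOut-injective {i = v} _ _ eq) , inj₂ b≡v)
... | no _ | no _ = inj₁ (FP.punchOut-injective {i = v} _ _ eq)

-- Where an edge map into Fin (suc k) lands after deleting the edge d
reindex : ∀ {k} (d : Fin (suc k)) → Maybe (Fin (suc k)) → Maybe (Fin k)
reindex d nothing = nothing
reindex d (just x) with d ≟ x
... | yes _ = nothing
... | no d≢x = just (punchOut d≢x)

reindex-just : ∀ {k} (d : Fin (suc k)) mx y → reindex d mx ≡ just y → mx ≡ just (punchIn d y)
reindex-just d (just x) y eq with d ≟ x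
reindex-just d (just x) y refl | no d≢x = cong just (sym (FP.punchIn-punchOut d≢x))

reindex-nothing : ∀ {k} (d : Fin (suc k)) mx → reindex d mx ≡ nothing → mx ≡ nothing ⊎ mx ≡ just d
reindex-nothing d nothing _ = inj₁ refl
reindex-nothing d (just x) eq with d ≟ x
reindex-nothing d (just x) eq | yes d≡x = inj₂ (cong just (sym d≡x))

reindex-punchIn : ∀ {k} (d : Fin (suc k)) y → reindex d (just (punchIn d y)) ≡ just y
reindex-punchIn d y with d ≟ punchIn d y
... | yes eq = contradiction (sym eq) (FP.punchInᵢ≢i d y)
... | no _ = cong just (trans (FP.punchOut-cong d refl) (FP.punchOut-punchIn d))

reindex-kept : ∀ {k} (d : Fin (suc k)) {mx x} → mx ≡ just x → x ≢ d → ∃[ y ] reindex d mx ≡ just y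
reindex-kept d {x = x} refl x≢d with d ≟ x
... | yes d≡x = contradiction (sym d≡x) x≢d
... | no d≢x = punchOut d≢x , refl

reindex-self : ∀ {k} (d : Fin (suc k)) → reindex d (just d) ≡ nothing
reindex-self d with d ≟ d
... | yes _ = refl
... | no d≢d = contradiction refl d≢d

graph : (n′ m′ : ℕ) → (Fin m′ → Fin n′ × Fin n′) → (Fin m′ → Bool) → SGraph
graph n′ m′ ends′ pos′ = record { n = n′ ; m = m′ ; ends = ends′ ; pos = pos′ }

flowStar-spoke : ∀ {K} (j : Fin K) → ends (flowStar K) (j F.↑ˡ K) ≡ (zero , suc j) × pos (flowStar K) (j F.↑ˡ K) ≡ true
flowStar-spoke {K} j rewrite FP.splitAt-↑ˡ K j K = refl , refl

flowStar-rim : ∀ {K} (i : Fin K) → ends (flowStar K) (K F.↑ʳ i) ≡ (suc i , suc (csuc i)) × pos (flowStar K) (K F.↑ʳ i) ≡ false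
flowStar-rim {K} i rewrite FP.splitAt-↑ʳ K K i = refl , refl

Joins-ends : ∀ {G G'} (τ : Fin (n G) → Fin (n G')) {z w α β} →
             Joins G z α β → Joins G' w (τ α) (τ β) → Joins G' w (τ (proj₁ (ends G z))) (τ (proj₂ (ends G z)))
Joins-ends {G} {G'} τ (inj₁ ends≡) j = Joins-cast {G = G'} refl (cong (τ ∘ proj₁) (sym ends≡)) (cong (τ ∘ proj₂) (sym ends≡)) j
Joins-ends {G} {G'} τ (inj₂ ends≡) j = Joins-cast {G = G'} refl (cong (τ ∘ proj₁) (sym ends≡)) (cong (τ ∘ proj₂) (sym ends≡))
                                         (Joins-sym {G = G'} j)

inverse-of : ∀ {A B : Set} (g : A → B) → Injective g → (∀ b → ∃[ a ] g a ≡ b) → B ↔ A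
inverse-of g g-injective g-surjective = mk↔ₛ′ (proj₁ ∘ g-surjective) g
  (λ a → g-injective _ a (proj₂ (g-surjective (g a)))) (proj₂ ∘ g-surjective)

module StarMinor (G : SGraph) (acyclic : PosAcyclic G) {k : ℕ} (Π : StarPattern G (suc (suc k))) where
  open StarPattern Π

  K : ℕ
  K = suc (suc k)

  count-t-path-self : ∀ i → count (t i) (path i) ≡ 1
  count-t-path-self i = trans (count-t-path i i) (cong₂ _+_ (δ-refl i) (δ-≢ λ i≡csuc-i → csuc-≢ i (sym i≡csuc-i)))

  Contracted : ∀ {l} → (Fin (m G) → Maybe (Fin l)) → Fin (m G) → Set
  Contracted ρ e = pos G e ≡ true × ρ e ≡ nothing

  -- H is a strong minor of G, explained by a surjection φ on vertices and a partial bijection ρ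
  -- on edges; an edge without image was deleted (if negative) or contracted (if positive).
  record MinorMap (H : SGraph) : Set where
    field
      minor : StrongMinor G H
      φ : Fin (n G) → Fin (n H)
      φ-surjective : ∀ z → ∃[ u ] φ u ≡ z
      ρ : Fin (m G) → Maybe (Fin (m H))
      ρ-kept : ∀ e x → ρ e ≡ just x → ends H x ≡ mapPair φ (ends G e) × pos H x ≡ pos G e
      ρ-dropped : ∀ e → ρ e ≡ nothing →
                  (pos G e ≡ true × φ (proj₁ (ends G e)) ≡ φ (proj₂ (ends G e))) ⊎ pos G e ≡ false
      ρ-surjective : ∀ x → ∃[ e ] ρ e ≡ just x
      ρ-injective : ∀ e e' x → ρ e ≡ just x → ρ e' ≡ just x → e ≡ e'
      fibre : ∀ u v → φ u ≡ φ v → Σ (Walk G u v) (All (Contracted ρ))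
      t-kept : ∀ j → ∃[ x ] ρ (t j) ≡ just x
      f-kept : ∀ i → ∃[ x ] ρ (f i) ≡ just x

  Essential : ∀ {H} → MinorMap H → Fin (m H) → Set
  Essential M x = (∃[ j ] ρ (t j) ≡ just x) ⊎ (∃[ i ] ρ (f i) ≡ just x)
    where open MinorMap M

  Essential? : ∀ {H} (M : MinorMap H) x → Dec (Essential M x)
  Essential? M x = FP.any? (λ j → ≡-dec _≟_ (ρ (t j)) (just x)) ⊎-dec FP.any? (λ i → ≡-dec _≟_ (ρ (f i)) (just x))
    where open MinorMap M

  Contracted-reindex : ∀ {l} (d : Fin (suc l)) {ρ : Fin (m G) → Maybe (Fin (suc l))} e →
                       Contracted ρ e → Contracted (reindex d ∘ ρ) e
  Contracted-reindex d e (pe , ρe) = pe , cong (reindex d) ρe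

  module MinorMapProperties {H : SGraph} (M : MinorMap H) where
    open MinorMap M

    fibreWalk : ∀ u v → φ u ≡ φ v → Walk G u v
    fibreWalk u v p = proj₁ (fibre u v p)

    fibreWalk-kept : ∀ u v p e x → ρ e ≡ just x → count e (fibreWalk u v p) ≡ 0
    fibreWalk-kept u v p e x ρe≡ = All-∉ (fibreWalk u v p) (proj₂ (fibre u v p)) e
      λ { (_ , ρe≡nothing) → nothing≢just (trans (sym ρe≡nothing) ρe≡) }
      where
      nothing≢just : nothing ≢ just x
      nothing≢just ()

    fibreWalk-positive : ∀ u v p → AllPos (fibreWalk u v p)
    fibreWalk-positive u v p = All-map (λ e → proj₁) (fibreWalk u v p) (proj₂ (fibre u v p))

    ρ-functional : ∀ e x y → ρ e ≡ just x → ρ e ≡ just y → x ≡ y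
    ρ-functional e x y p q = just-injective (trans (sym p) q)

    ρ-injective′ : ∀ {e e' x x'} → ρ e ≡ just x → ρ e' ≡ just x' → x ≡ x' → e ≡ e'
    ρ-injective′ {e} {e'} ρe≡ ρe'≡ refl = ρ-injective e e' _ ρe≡ ρe'≡

    δ-ρ : ∀ {e e' x x'} → ρ e ≡ just x → ρ e' ≡ just x' → δ x x' ≡ δ e e'
    δ-ρ {e} {e'} {x} {x'} p q = δ-cong (ρ-injective′ p q)
                                       (λ { refl → ρ-functional e x x' p q })

    Joins-ρ : ∀ {e x a b} → ρ e ≡ just x → Joins G e a b → Joins H x (φ a) (φ b)
    Joins-ρ {e} {x} ρe≡ (inj₁ p) = inj₁ (trans (proj₁ (ρ-kept e x ρe≡)) (cong (mapPair φ) p))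
    Joins-ρ {e} {x} ρe≡ (inj₂ p) = inj₂ (trans (proj₁ (ρ-kept e x ρe≡)) (cong (mapPair φ) p))

    Across : Fin (m G) → Fin (n G) → Fin (n G) → Set
    Across ê a b = Σ (Walk G a b) λ W → AllPos W × count ê W ≡ 1 × (∀ e x → ρ e ≡ just x → e ≢ ê → count e W ≡ 0)

    walk-through : ∀ {ê x̂ p q a b} → ρ ê ≡ just x̂ → pos G ê ≡ true → Joins G ê p q →
                   φ a ≡ φ p → φ b ≡ φ q → Across ê a b
    walk-through {ê} {x̂} {p} {q} {a} {b} ρê pê j a~p b~q =
      Wa ++ step ê j Wb , All-++ Wa _ (fibreWalk-positive _ _ _) (pê , fibreWalk-positive _ _ _)
      , trans (count-++ ê Wa _)
              (cong₂ _+_ (fibreWalk-kept _ _ _ ê x̂ ρê) (cong₂ _+_ (δ-refl ê) (fibreWalk-kept _ _ _ ê x̂ ρê)))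
      , λ e x ρe e≢ê → trans (count-++ e Wa _)
                             (cong₂ _+_ (fibreWalk-kept _ _ _ e x ρe) (cong₂ _+_ (δ-≢ e≢ê) (fibreWalk-kept _ _ _ e x ρe)))
      where
      Wa = fibreWalk a p a~p
      Wb = fibreWalk q b (sym b~q)

    walk-across : ∀ {ê x̂ p q} → ρ ê ≡ just x̂ → pos G ê ≡ true → Joins G ê p q → ∀ a b →
                  (φ a ≡ φ p × φ b ≡ φ q) ⊎ (φ a ≡ φ q × φ b ≡ φ p) → Across ê a b
    walk-across ρê pê j a b (inj₁ (a~p , b~q)) = walk-through ρê pê j a~p b~q
    walk-across ρê pê j a b (inj₂ (a~q , b~p)) = walk-through ρê pê (Joins-sym {G = G} j) a~q b~p

  delete-step : ∀ {n′ m′ ends′ pos′} (M : MinorMap (graph n′ (suc m′) ends′ pos′)) (d : Fin (suc m′)) →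
                pos′ d ≡ false → ¬ Essential M d → MinorMap (graph n′ m′ (ends′ ∘ punchIn d) (pos′ ∘ punchIn d))
  delete-step M d d-negative d-inessential = record
    { minor = more minor (del d (refl , refl , λ y → refl , refl))
    ; φ = φ
    ; φ-surjective = φ-surjective
    ; ρ = reindex d ∘ ρ
    ; ρ-kept = λ e y eq → ρ-kept e (punchIn d y) (reindex-just d (ρ e) y eq)
    ; ρ-dropped = dropped
    ; ρ-surjective = λ y → proj₁ (ρ-surjective (punchIn d y))
                          , trans (cong (reindex d) (proj₂ (ρ-surjective (punchIn d y)))) (reindex-punchIn d y)
    ; ρ-injective = λ e e' y p q → ρ-injective e e' (punchIn d y) (reindex-just d (ρ e) y p) (reindex-just d (ρ e') y q)
    ; fibre = λ u v p → proj₁ (fibre u v p) , All-map (Contracted-reindex d) _ (proj₂ (fibre u v p))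
    ; t-kept = λ j → reindex-kept d (proj₂ (t-kept j)) λ { refl → d-inessential (inj₁ (j , proj₂ (t-kept j))) }
    ; f-kept = λ i → reindex-kept d (proj₂ (f-kept i)) λ { refl → d-inessential (inj₂ (i , proj₂ (f-kept i))) }
    }
    where
    open MinorMap M
    dropped : ∀ e → reindex d (ρ e) ≡ nothing →
              (pos G e ≡ true × φ (proj₁ (ends G e)) ≡ φ (proj₂ (ends G e))) ⊎ pos G e ≡ false
    dropped e eq with reindex-nothing d (ρ e) eq
    ... | inj₁ ρe≡nothing = ρ-dropped e ρe≡nothing
    ... | inj₂ ρe≡d = inj₂ (trans (sym (proj₂ (ρ-kept e d ρe≡d))) d-negative)

  module Contractible {H : SGraph} (M : MinorMap H) (d : Fin (m H)) (d-positive : pos H d ≡ true)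
                      (d-inessential : ¬ Essential M d) (negatives-essential : ∀ y → pos H y ≡ false → Essential M y) where
    open MinorMap M
    private module P = MinorMapProperties M

    ê = proj₁ (ρ-surjective d)
    ρê = proj₂ (ρ-surjective d)
    ê-positive : pos G ê ≡ true
    ê-positive = trans (sym (proj₂ (ρ-kept ê d ρê))) d-positive
    p = proj₁ (ends G ê)
    q = proj₂ (ends G ê)
    u = proj₁ (ends H d)
    v = proj₂ (ends H d)
    u≡φp : u ≡ φ p
    u≡φp = cong proj₁ (proj₁ (ρ-kept ê d ρê))
    v≡φq : v ≡ φ q
    v≡φq = cong proj₂ (proj₁ (ρ-kept ê d ρê))

    u≢v : u ≢ v
    u≢v u≡v = acyclic⇒no-closed-walk-crossing-once acyclic ê (step ê (inj₁ refl) (P.fibreWalk q p q~p))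
      (ê-positive , P.fibreWalk-positive q p q~p) (cong₂ _+_ (δ-refl ê) (P.fibreWalk-kept q p q~p ê d ρê))
      where
      q~p : φ q ≡ φ p
      q~p = trans (sym v≡φq) (trans (sym u≡v) u≡φp)

    t≢ê : ∀ j → t j ≢ ê
    t≢ê j t≡ê = d-inessential (inj₁ (j , trans (cong ρ t≡ê) ρê))

    parallel-ends : ∀ {e y a b} → ρ e ≡ just y → Joins G e a b → Joins H y u v →
                    (φ a ≡ φ p × φ b ≡ φ q) ⊎ (φ a ≡ φ q × φ b ≡ φ p)
    parallel-ends ρe≡ j y-joins = Joins-unique {G = H} (P.Joins-ρ ρe≡ j) (Joins-cast {G = H} refl u≡φp v≡φq y-joins)

    -- A parallel positive edge closes a walk across ê to a closed positive walk crossing ê once.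
    no-positive-parallel : ∀ y → y ≢ d → Joins H y u v → pos H y ≡ true → ⊥
    no-positive-parallel y y≢d y-joins py =
      acyclic⇒no-closed-walk-crossing-once acyclic ê (step ŷ (inj₁ refl) W) (ŷ-positive , W-positive)
        (trans (cong (_+ count ê W) (δ-≢ λ ê≡ŷ → y≢d (P.ρ-functional ŷ y d ρŷ (subst (λ e → ρ e ≡ just d) ê≡ŷ ρê))))
               ê-once)
      where
      ŷ = proj₁ (ρ-surjective y)
      ρŷ = proj₂ (ρ-surjective y)
      ŷ-positive = trans (sym (proj₂ (ρ-kept ŷ y ρŷ))) py
      across = P.walk-across ρê ê-positive (inj₁ refl) (proj₂ (ends G ŷ)) (proj₁ (ends G ŷ)) (parallel-ends ρŷ (inj₂ refl) y-joins)
      W = proj₁ across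
      W-positive = proj₁ (proj₂ across)
      ê-once = proj₁ (proj₂ (proj₂ across))

    -- A parallel negative edge is some f i; path i closes a walk across ê to a closed positive
    -- walk crossing t i once.
    no-negative-parallel : ∀ y → Joins H y u v → pos H y ≡ false → Essential M y → ⊥
    no-negative-parallel y y-joins py (inj₁ (j , ρt≡))
      with () ← trans (sym (t-positive j)) (trans (sym (proj₂ (ρ-kept (t j) y ρt≡))) py)
    no-negative-parallel y y-joins py (inj₂ (i , ρf≡)) =
      acyclic⇒no-closed-walk-crossing-once acyclic (t i) (path i ++ W) (All-++ (path i) W (path-positive i) W-positive)
        (trans (count-++ (t i) (path i) W) (cong₂ _+_ (count-t-path-self i) (others (t i) _ (proj₂ (t-kept i)) (t≢ê i))))
      where
      across = P.walk-across ρê ê-positive (inj₁ refl) (src i) (tgt i) (parallel-ends ρf≡ (f-joins i) y-joins)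
      W = proj₁ across
      W-positive = proj₁ (proj₂ across)
      others = proj₂ (proj₂ (proj₂ across))

    no-parallel : ∀ y → y ≢ d → ¬ Joins H y u v
    no-parallel y y≢d y-joins with pos H y in py
    ... | true = no-positive-parallel y y≢d y-joins py
    ... | false = no-negative-parallel y y-joins py (negatives-essential y py)

  contract-step : ∀ {n′ m′ ends′ pos′} (M : MinorMap (graph (suc n′) (suc m′) ends′ pos′)) (d : Fin (suc m′)) →
    (d-positive : pos′ d ≡ true) → ¬ Essential M d →
    (u≢v : proj₁ (ends′ d) ≢ proj₂ (ends′ d)) →
    (∀ y → y ≢ d → ¬ Joins (graph (suc n′) (suc m′) ends′ pos′) y (proj₁ (ends′ d)) (proj₂ (ends′ d))) →
    MinorMap (graph n′ m′ (λ y → mapPair (merge (proj₁ (ends′ d)) (proj₂ (ends′ d)) u≢v) (ends′ (punchIn d y)))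
                          (pos′ ∘ punchIn d))
  contract-step {n′} {m′} {ends′} {pos′} M d d-positive d-inessential u≢v no-parallel = record
    { minor = more minor (con d (refl , refl , d-positive , u≢v , no-parallel , λ y → refl , refl))
    ; φ = merged ∘ φ
    ; φ-surjective = λ z → proj₁ (φ-surjective (punchIn v z))
                         , trans (cong merged (proj₂ (φ-surjective (punchIn v z)))) (merge-punchIn u v u≢v z)
    ; ρ = reindex d ∘ ρ
    ; ρ-kept = λ e y eq → let kept = ρ-kept e (punchIn d y) (reindex-just d (ρ e) y eq) in
                          cong (mapPair merged) (proj₁ kept) , proj₂ kept
    ; ρ-dropped = dropped
    ; ρ-surjective = λ y → proj₁ (ρ-surjective (punchIn d y))
                          , trans (cong (reindex d) (proj₂ (ρ-surjective (punchIn d y)))) (reindex-punchIn d y)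
    ; ρ-injective = λ e e' y p q → ρ-injective e e' (punchIn d y) (reindex-just d (ρ e) y p) (reindex-just d (ρ e') y q)
    ; fibre = fibre′
    ; t-kept = λ j → reindex-kept d (proj₂ (t-kept j)) λ { refl → d-inessential (inj₁ (j , proj₂ (t-kept j))) }
    ; f-kept = λ i → reindex-kept d (proj₂ (f-kept i)) λ { refl → d-inessential (inj₂ (i , proj₂ (f-kept i))) }
    }
    where
    open MinorMap M
    u = proj₁ (ends′ d)
    v = proj₂ (ends′ d)
    merged = merge u v u≢v
    ê = proj₁ (ρ-surjective d)
    ρê = proj₂ (ρ-surjective d)
    ê-positive : pos G ê ≡ true
    ê-positive = trans (sym (proj₂ (ρ-kept ê d ρê))) d-positive
    p = proj₁ (ends G ê)
    q = proj₂ (ends G ê)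
    u≡φp : u ≡ φ p
    u≡φp = cong proj₁ (proj₁ (ρ-kept ê d ρê))
    v≡φq : v ≡ φ q
    v≡φq = cong proj₂ (proj₁ (ρ-kept ê d ρê))
    ê-identified : merged (φ p) ≡ merged (φ q)
    ê-identified = trans (cong merged (sym u≡φp)) (trans (merge-identifies u v u≢v) (cong merged v≡φq))
    dropped : ∀ e → reindex d (ρ e) ≡ nothing →
              (pos G e ≡ true × merged (φ (proj₁ (ends G e))) ≡ merged (φ (proj₂ (ends G e)))) ⊎ pos G e ≡ false
    dropped e eq with reindex-nothing d (ρ e) eq
    ... | inj₂ ρe≡d = inj₁ (subst (λ z → pos G z ≡ true × merged (φ (proj₁ (ends G z))) ≡ merged (φ (proj₂ (ends G z))))
                                  (sym (ρ-injective e ê d ρe≡d ρê)) (ê-positive , ê-identified))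
    ... | inj₁ ρe≡nothing with ρ-dropped e ρe≡nothing
    ...   | inj₁ (pe , identified) = inj₁ (pe , cong merged identified)
    ...   | inj₂ negative = inj₂ negative
    reindexed : ∀ {a b} (W : Walk G a b) → All (Contracted ρ) W → All (Contracted (reindex d ∘ ρ)) W
    reindexed = All-map (Contracted-reindex d)
    ê-contracted : Contracted (reindex d ∘ ρ) ê
    ê-contracted = ê-positive , trans (cong (reindex d) ρê) (reindex-self d)
    to-p : ∀ a → φ a ≡ u ⊎ φ a ≡ v → Σ (Walk G a p) (All (Contracted (reindex d ∘ ρ)))
    to-p a (inj₁ φa≡u) = let (W , contracted) = fibre a p (trans φa≡u u≡φp) in W , reindexed W contracted
    to-p a (inj₂ φa≡v) = let (W , contracted) = fibre a q (trans φa≡v v≡φq) in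
                         W ++ step ê (inj₂ refl) [] , All-++ W _ (reindexed W contracted) (ê-contracted , tt)
    fibre′ : ∀ a b → merged (φ a) ≡ merged (φ b) → Σ (Walk G a b) (All (Contracted (reindex d ∘ ρ)))
    fibre′ a b eq with merge-identified u v u≢v (φ a) (φ b) eq
    ... | inj₁ φa≡φb = let (W , contracted) = fibre a b φa≡φb in W , reindexed W contracted
    ... | inj₂ (a∈uv , b∈uv) = let (Wa , ca) = to-p a a∈uv ; (Wb , cb) = to-p b b∈uv in
                               Wa ++ reverse Wb , All-++ Wa (reverse Wb) ca (All-reverse Wb cb)

  EssentialMinor : Set
  EssentialMinor = Σ SGraph λ H → Σ (MinorMap H) λ M → ∀ x → Essential M x

  reduce : ∀ n′ m′ ends′ pos′ → MinorMap (graph n′ m′ ends′ pos′) → EssentialMinor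
  reduce n′ zero ends′ pos′ M = _ , M , λ ()
  reduce zero (suc m′) ends′ pos′ M with () ← proj₁ (ends′ zero)
  reduce (suc n′) (suc m′) ends′ pos′ M with FP.any? (λ x → ¬? (Essential? M x) ×-dec (pos′ x B.≟ false))
  ... | yes (x , inessential , negative) = reduce (suc n′) m′ _ _ (delete-step M x negative inessential)
  ... | no no-inessential-negative with FP.any? (λ x → ¬? (Essential? M x))
  ...   | no all-essential = _ , M , λ x → decidable-stable (Essential? M x) λ inessential → all-essential (x , inessential)
  ...   | yes (x , inessential) with pos′ x in positive
  ...     | false = contradiction (x , inessential , positive) no-inessential-negative
  ...     | true = reduce n′ m′ _ _ (contract-step M x positive inessential C.u≢v C.no-parallel)
    where
    negatives-essential : ∀ y → pos′ y ≡ false → Essential M y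
    negatives-essential y negative = decidable-stable (Essential? M y) λ inessential → no-inessential-negative (y , inessential , negative)
    module C = Contractible M x positive inessential negatives-essential

  identity : MinorMap (graph (n G) (m G) (ends G) (pos G))
  identity = record
    { minor = done ; φ = λ u → u ; φ-surjective = λ z → z , refl ; ρ = just
    ; ρ-kept = λ { e x refl → refl , refl } ; ρ-dropped = λ e () ; ρ-surjective = λ x → x , refl
    ; ρ-injective = λ { e e' x refl refl → refl } ; fibre = λ { u v refl → [] , tt }
    ; t-kept = λ j → t j , refl ; f-kept = λ i → f i , refl }

  module Lifting {H : SGraph} (M : MinorMap H) where
    open MinorMap M
    open MinorMapProperties M

    CountsAgree : ∀ {a b α β} → Walk G a b → Walk H α β → Set
    CountsAgree W V = ∀ e x → ρ e ≡ just x → count e W ≡ count x V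

    image : ∀ {a b} (W : Walk G a b) → AllPos W → Σ (Walk H (φ a) (φ b)) λ V → AllPos V × CountsAgree W V
    image [] _ = [] , tt , λ _ _ _ → refl
    image (step {a} {w} e j W) (pe , W-positive) with image W W-positive | ρ e in ρe≡
    ... | V , V-positive , agree | just x =
          step x (Joins-ρ ρe≡ j) V , (trans (proj₂ (ρ-kept e x ρe≡)) pe , V-positive)
          , λ e' x' ρe'≡ → cong₂ _+_ (sym (δ-ρ ρe'≡ ρe≡)) (agree e' x' ρe'≡)
    ... | V , V-positive , agree | nothing with ρ-dropped e ρe≡
    ...   | inj₂ negative with () ← trans (sym pe) negative
    ...   | inj₁ (_ , identified) =
          cast {G = H} (sym φa≡φw) refl V , All-cast {G = H} (sym φa≡φw) refl V V-positive
          , λ e' x' ρe'≡ → trans (cong (_+ count e' W) (δ-≢ λ { refl → nothing≢just (trans (sym ρe≡) ρe'≡) }))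
                                 (trans (agree e' x' ρe'≡) (sym (count-cast {G = H} x' (sym φa≡φw) refl V)))
      where
      nothing≢just : ∀ {y} → nothing ≢ just y
      nothing≢just ()
      φa≡φw : φ a ≡ φ w
      φa≡φw = [ (λ ends≡ → trans (cong (φ ∘ proj₁) (sym ends≡)) (trans identified (cong (φ ∘ proj₂) ends≡)))
              , (λ ends≡ → sym (trans (cong (φ ∘ proj₁) (sym ends≡)) (trans identified (cong (φ ∘ proj₂) ends≡)))) ]′ j

    preimage : ∀ {x α w} → Joins H x α w →
               Σ (Fin (m G)) λ e → ρ e ≡ just x × Σ (Fin (n G)) λ a → Σ (Fin (n G)) λ b → Joins G e a b × φ a ≡ α × φ b ≡ w
    preimage {x} J with ρ-surjective x
    ... | e , ρe≡ with Joins-unique {G = H} (Joins-ρ ρe≡ (inj₁ refl)) J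
    ...   | inj₁ (φa≡α , φb≡w) = e , ρe≡ , _ , _ , inj₁ refl , φa≡α , φb≡w
    ...   | inj₂ (φa≡w , φb≡α) = e , ρe≡ , _ , _ , inj₂ refl , φb≡α , φa≡w

    lift : ∀ {α β} (V : Walk H α β) → AllPos V → ∀ u → φ u ≡ α →
           Σ (Fin (n G)) λ v → φ v ≡ β × Σ (Walk G u v) λ W → AllPos W × CountsAgree W V
    lift [] _ u φu≡ = u , φu≡ , [] , tt , λ _ _ _ → refl
    lift (step x J V) (px , V-positive) u φu≡ with preimage J
    ... | e , ρe≡ , a , b , je , φa≡ , φb≡ with lift V V-positive b φb≡
    ...   | v , φv≡ , W′ , W′-positive , agree = v , φv≡ , Wu ++ step e je W′
            , All-++ Wu _ (fibreWalk-positive _ _ _) (trans (sym (proj₂ (ρ-kept e x ρe≡))) px , W′-positive)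
            , λ e₀ x₀ ρe₀≡ → trans (count-++ e₀ Wu _) (trans (cong (_+ _) (fibreWalk-kept _ _ _ e₀ x₀ ρe₀≡))
                               (cong₂ _+_ (sym (δ-ρ ρe₀≡ ρe≡)) (agree e₀ x₀ ρe₀≡)))
      where
      Wu = fibreWalk u a (trans φu≡ (sym φa≡))

    minor-acyclic : ∀ {α} x (V : Walk H α α) → AllPos V → count x V ≡ 1 → ⊥
    minor-acyclic {α} x V V-positive once with φ-surjective α
    ... | u , φu≡ with lift V V-positive u φu≡ | ρ-surjective x
    ...   | v , φv≡ , W , W-positive , agree | e , ρe≡ =
            acyclic⇒no-closed-walk-crossing-once acyclic e (W ++ Wv) (All-++ W Wv W-positive (fibreWalk-positive _ _ _))
              (trans (count-++ e W Wv) (trans (cong₂ _+_ (agree e x ρe≡) (fibreWalk-kept _ _ _ e x ρe≡)) (trans (+-identityʳ _) once)))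
      where
      Wv = fibreWalk v u (trans φv≡ (sym φu≡))

  module EssentialMinorIsStar (connected : PosConnected G) {H : SGraph} (M : MinorMap H)
                              (all-essential : ∀ x → Essential M x) where
    open MinorMap M
    open MinorMapProperties M
    open Lifting M

    T F : Fin K → Fin (m H)
    T j = proj₁ (t-kept j)
    F i = proj₁ (f-kept i)

    T-injective : Injective T
    T-injective j j' eq = t-injective j j' (ρ-injective′ (proj₂ (t-kept j)) (proj₂ (t-kept j')) eq)

    F-injective : Injective F
    F-injective i i' eq = f-injective i i' (ρ-injective′ (proj₂ (f-kept i)) (proj₂ (f-kept i')) eq)

    T-positive : ∀ j → pos H (T j) ≡ true
    T-positive j = trans (proj₂ (ρ-kept (t j) (T j) (proj₂ (t-kept j)))) (t-positive j)

    F-negative : ∀ i → pos H (F i) ≡ false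
    F-negative i = trans (proj₂ (ρ-kept (f i) (F i) (proj₂ (f-kept i)))) (f-negative i)

    T≢F : ∀ j i → T j ≢ F i
    T≢F j i = positive≢negative {G = H} (T-positive j) (F-negative i)

    T-or-F : ∀ x → (∃[ j ] x ≡ T j) ⊎ (∃[ i ] x ≡ F i)
    T-or-F x with all-essential x
    ... | inj₁ (j , ρt≡) = inj₁ (j , ρ-functional (t j) x (T j) ρt≡ (proj₂ (t-kept j)))
    ... | inj₂ (i , ρf≡) = inj₂ (i , ρ-functional (f i) x (F i) ρf≡ (proj₂ (f-kept i)))

    Q : ∀ i → Walk H (φ (tgt i)) (φ (src i))
    Q i = proj₁ (image (path i) (path-positive i))

    count-Q : ∀ i z → count z (Q i) ≡ δ z (T i) + δ z (T (csuc i))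
    count-Q i z with T-or-F z
    ... | inj₁ (j , refl) = begin
      count (T j) (Q i)             ≡⟨ sym (agree (t j) (T j) (proj₂ (t-kept j))) ⟩
      count (t j) (path i)          ≡⟨ count-t-path i j ⟩
      δ j i + δ j (csuc i)          ≡⟨ sym (cong₂ _+_ (δ-T j i) (δ-T j (csuc i))) ⟩
      δ (T j) (T i) + δ (T j) (T (csuc i)) ∎
      where
      open ≡-Reasoning
      agree = proj₂ (proj₂ (image (path i) (path-positive i)))
      δ-T : ∀ j j' → δ (T j) (T j') ≡ δ j j'
      δ-T j j' = δ-cong (T-injective j j') (cong T)
    ... | inj₂ (i' , refl) = trans (sym (agree (f i') (F i') (proj₂ (f-kept i'))))
                               (trans (All-∉ (path i) (path-positive i) (f i') λ pf → positive≢negative {G = G} pf (f-negative i') refl)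
                                      (sym (cong₂ _+_ (δ-≢ λ e → T≢F i i' (sym e)) (δ-≢ λ e → T≢F (csuc i) i' (sym e)))))
      where
      agree = proj₂ (proj₂ (image (path i) (path-positive i)))

    record Wedge (i : Fin K) : Set where
      field
        centre left right : Fin (n H)
        spoke-left : Joins H (T i) left centre
        spoke-right : Joins H (T (csuc i)) centre right
        rim : Joins H (F i) left right

    wedge : ∀ i → Wedge i
    wedge i with count≡δ+δ⇒two-steps (Q i) (T i) (T (csuc i)) (λ e → csuc-≢ i (sym (T-injective _ _ e))) (count-Q i)
    ... | c , inj₁ (J₁ , J₂) = record { centre = c ; left = φ (tgt i) ; right = φ (src i) ; spoke-left = J₁ ; spoke-right = J₂
                                      ; rim = Joins-sym {G = H} (Joins-ρ (proj₂ (f-kept i)) (f-joins i)) }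
    ... | c , inj₂ (J₁ , J₂) = record { centre = c ; left = φ (src i) ; right = φ (tgt i) ; spoke-left = Joins-sym {G = H} J₂
                                      ; spoke-right = Joins-sym {G = H} J₁ ; rim = Joins-ρ (proj₂ (f-kept i)) (f-joins i) }

    centre : Fin K → Fin (n H)
    centre i = Wedge.centre (wedge i)

    -- If two consecutive centres differed, the spoke between them would be crossed once by the
    -- positive closed walk through all centres.
    centre-csuc : ∀ i → centre i ≡ centre (csuc i)
    centre-csuc i₀ with centre i₀ ≟ centre (csuc i₀)
    ... | yes same = same
    ... | no differ = ⊥-elim (minor-acyclic (T (csuc i₀)) (CyclicConcat.closed {G = H} centre seg)
                        (CyclicConcat.closed-All {G = H} centre seg λ i → seg-positive i (centre i ≟ centre (csuc i)))
                        (trans (CyclicConcat.count-closed {G = H} centre seg (T (csuc i₀)) i₀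
                                  λ i i≢i₀ → seg-other i (centre i ≟ centre (csuc i)) i≢i₀)
                               (seg-self (centre i₀ ≟ centre (csuc i₀)))))
      where
      centres-joined : ∀ i → centre i ≢ centre (csuc i) → Joins H (T (csuc i)) (centre i) (centre (csuc i))
      centres-joined i differ with Joins-unique {G = H} (Wedge.spoke-right (wedge i)) (Wedge.spoke-left (wedge (csuc i)))
      ... | inj₂ (same , _) = contradiction same differ
      ... | inj₁ (centre≡left , _) = Joins-cast {G = H} refl (sym centre≡left) refl (Wedge.spoke-left (wedge (csuc i)))
      seg′ : ∀ i → Dec (centre i ≡ centre (csuc i)) → Walk H (centre i) (centre (csuc i))
      seg′ i (yes same) = cast {G = H} refl same []
      seg′ i (no differ) = step (T (csuc i)) (centres-joined i differ) []
      seg : ∀ i → Walk H (centre i) (centre (csuc i))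
      seg i = seg′ i (centre i ≟ centre (csuc i))
      seg-positive : ∀ i d → AllPos (seg′ i d)
      seg-positive i (yes same) = All-cast {G = H} refl same [] tt
      seg-positive i (no _) = T-positive (csuc i) , tt
      seg-other : ∀ i d → i ≢ i₀ → count (T (csuc i₀)) (seg′ i d) ≡ 0
      seg-other i (yes same) _ = count-cast {G = H} _ refl same []
      seg-other i (no _) i≢i₀ = cong (_+ 0) (δ-≢ λ e → i≢i₀ (sym (csuc-injective i₀ i (T-injective _ _ e))))
      seg-self : ∀ d → count (T (csuc i₀)) (seg′ i₀ d) ≡ 1
      seg-self (yes same) = contradiction same differ
      seg-self (no _) = cong (_+ 0) (δ-refl (T (csuc i₀)))

    hub : Fin (n H)
    hub = centre zero

    leaf : Fin K → Fin (n H)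
    leaf i = Wedge.left (wedge i)

    spoke : ∀ i → Joins H (T i) (leaf i) hub
    spoke i = Joins-cast {G = H} refl refl (csuc-invariant centre centre-csuc i) (Wedge.spoke-left (wedge i))

    rim : ∀ i → Joins H (F i) (leaf i) (leaf (csuc i))
    rim i = Joins-cast {G = H} refl refl right≡ (Wedge.rim (wedge i))
      where
      right≡ : Wedge.right (wedge i) ≡ leaf (csuc i)
      right≡ = Joins-other {G = H}
        (Joins-cast {G = H} refl (csuc-invariant centre centre-csuc i) refl (Wedge.spoke-right (wedge i))) (spoke (csuc i))

    leaf≢hub : ∀ i → leaf i ≢ hub
    leaf≢hub i leaf≡hub = minor-acyclic (T i) (step (T i) (Joins-cast {G = H} refl leaf≡hub refl (spoke i)) [])
                            (T-positive i , tt) (cong (_+ 0) (δ-refl (T i)))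

    leaf-injective : Injective leaf
    leaf-injective i j same with i ≟ j
    ... | yes i≡j = i≡j
    ... | no i≢j = ⊥-elim (minor-acyclic (T i)
                     (step (T i) (Joins-sym {G = H} (spoke i)) (step (T j) (Joins-cast {G = H} refl (sym same) refl (spoke j)) []))
                     (T-positive i , T-positive j , tt)
                     (cong₂ _+_ (δ-refl (T i)) (cong (_+ 0) (δ-≢ λ e → i≢j (T-injective _ _ e)))))

    HubOrLeaf : Fin (n H) → Set
    HubOrLeaf z = z ≡ hub ⊎ ∃[ j ] z ≡ leaf j

    -- the only positive edges of H are the spokes
    HubOrLeaf-positive-walk : ∀ {a b} (V : Walk H a b) → AllPos V → HubOrLeaf a → HubOrLeaf b
    HubOrLeaf-positive-walk [] _ h = h
    HubOrLeaf-positive-walk (step x J V) (px , V-positive) h with T-or-F x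
    ... | inj₂ (i , refl) with () ← trans (sym px) (F-negative i)
    ... | inj₁ (j , refl) with Joins-unique {G = H} J (spoke j)
    ...   | inj₁ (_ , w≡hub) = HubOrLeaf-positive-walk V V-positive (inj₁ w≡hub)
    ...   | inj₂ (_ , w≡leaf) = HubOrLeaf-positive-walk V V-positive (inj₂ (j , w≡leaf))

    hubOrLeaf : ∀ z → HubOrLeaf z
    hubOrLeaf z with φ-surjective hub | φ-surjective z
    ... | u , φu≡ | w , φw≡ = HubOrLeaf-positive-walk (cast {G = H} φu≡ φw≡ V) (All-cast {G = H} φu≡ φw≡ V V-positive) (inj₁ refl)
      where
      W = PosWalk⇒Walk (connected u w)
      V = proj₁ (image (proj₁ W) (proj₂ W))
      V-positive = proj₁ (proj₂ (image (proj₁ W) (proj₂ W)))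

    vertexOf : Fin (suc K) → Fin (n H)
    vertexOf zero = hub
    vertexOf (suc j) = leaf j

    vertexOf-injective : Injective vertexOf
    vertexOf-injective zero zero _ = refl
    vertexOf-injective zero (suc j) eq = contradiction (sym eq) (leaf≢hub j)
    vertexOf-injective (suc i) zero eq = contradiction eq (leaf≢hub i)
    vertexOf-injective (suc i) (suc j) eq = cong suc (leaf-injective i j eq)

    vertexOf-surjective : ∀ z → ∃[ a ] vertexOf a ≡ z
    vertexOf-surjective z with hubOrLeaf z
    ... | inj₁ z≡hub = zero , sym z≡hub
    ... | inj₂ (j , z≡leaf) = suc j , sym z≡leaf

    edgeOf : Fin (K + K) → Fin (m H)
    edgeOf w = [ T , F ]′ (splitAt K w)

    [T,F]-injective : Injective [ T , F ]′
    [T,F]-injective (inj₁ j) (inj₁ j') eq = cong inj₁ (T-injective j j' eq)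
    [T,F]-injective (inj₁ j) (inj₂ i) eq = contradiction eq (T≢F j i)
    [T,F]-injective (inj₂ i) (inj₁ j) eq = contradiction (sym eq) (T≢F j i)
    [T,F]-injective (inj₂ i) (inj₂ i') eq = cong inj₂ (F-injective i i' eq)

    edgeOf-injective : Injective edgeOf
    edgeOf-injective w w' eq = begin
      w                           ≡⟨ sym (FP.join-splitAt K K w) ⟩
      F.join K K (splitAt K w)    ≡⟨ cong (F.join K K) ([T,F]-injective (splitAt K w) (splitAt K w') eq) ⟩
      F.join K K (splitAt K w')   ≡⟨ FP.join-splitAt K K w' ⟩
      w'                          ∎
      where open ≡-Reasoning

    edgeOf-surjective : ∀ z → ∃[ w ] edgeOf w ≡ z
    edgeOf-surjective z with T-or-F z
    ... | inj₁ (j , z≡T) = j F.↑ˡ K , trans (cong [ T , F ]′ (FP.splitAt-↑ˡ K j K)) (sym z≡T)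
    ... | inj₂ (i , z≡F) = K F.↑ʳ i , trans (cong [ T , F ]′ (FP.splitAt-↑ʳ K K i)) (sym z≡F)

    vertexIndex : Fin (n H) ↔ Fin (suc K)
    vertexIndex = inverse-of vertexOf vertexOf-injective vertexOf-surjective

    edgeIndex : Fin (m H) ↔ Fin (K + K)
    edgeIndex = inverse-of edgeOf edgeOf-injective edgeOf-surjective

    τ : Fin (n H) → Fin (suc K)
    τ = Inverse.to vertexIndex

    τ-vertexOf : ∀ a → τ (vertexOf a) ≡ a
    τ-vertexOf a = vertexOf-injective _ a (proj₂ (vertexOf-surjective (vertexOf a)))

    FS = flowStar K

    Matches : Fin (K + K) → Fin (m H) → Set
    Matches w z = pos FS w ≡ pos H z × Joins FS w (τ (proj₁ (ends H z))) (τ (proj₂ (ends H z)))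

    spoke-matches : ∀ j → Matches (j F.↑ˡ K) (T j)
    spoke-matches j = trans (proj₂ (flowStar-spoke j)) (sym (T-positive j))
                    , Joins-ends {G = H} {G' = FS} τ {w = j F.↑ˡ K} (spoke j)
                        (inj₂ (trans (proj₁ (flowStar-spoke j)) (cong₂ _,_ (sym (τ-vertexOf zero)) (sym (τ-vertexOf (suc j))))))

    rim-matches : ∀ i → Matches (K F.↑ʳ i) (F i)
    rim-matches i = trans (proj₂ (flowStar-rim i)) (sym (F-negative i))
                  , Joins-ends {G = H} {G' = FS} τ {w = K F.↑ʳ i} (rim i)
                      (inj₁ (trans (proj₁ (flowStar-rim i)) (cong₂ _,_ (sym (τ-vertexOf (suc i))) (sym (τ-vertexOf (suc (csuc i)))))))

    edgeOf-matches : ∀ w → Matches w (edgeOf w)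
    edgeOf-matches w = by-split (splitAt K w) refl
      where
      by-split : ∀ s → splitAt K w ≡ s → Matches w (edgeOf w)
      by-split (inj₁ j) split≡ = subst (λ w′ → Matches w′ (edgeOf w′)) (FP.splitAt⁻¹-↑ˡ {i = w} split≡)
        (subst (Matches (j F.↑ˡ K)) (sym (cong [ T , F ]′ (FP.splitAt-↑ˡ K j K))) (spoke-matches j))
      by-split (inj₂ i) split≡ = subst (λ w′ → Matches w′ (edgeOf w′)) (FP.splitAt⁻¹-↑ʳ {i = w} split≡)
        (subst (Matches (K F.↑ʳ i)) (sym (cong [ T , F ]′ (FP.splitAt-↑ʳ K K i))) (rim-matches i))

    iso : Iso H FS
    iso = vertexIndex , edgeIndex
        , λ z → subst (Matches (Inverse.to edgeIndex z)) (proj₂ (edgeOf-surjective z)) (edgeOf-matches (Inverse.to edgeIndex z))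

  flowStar-minor : PosConnected G → Σ SGraph λ H → StrongMinor G H × Iso H (flowStar K)
  flowStar-minor connected with reduce (n G) (m G) (ends G) (pos G) identity
  ... | H , M , all-essential = H , MinorMap.minor M , EssentialMinorIsStar.iso connected M all-essential

lemma6 : (G : SGraph) → PosTree G → ¬ HasOddFlowStarStrongMinor G →
    BalancedFlowMatrix G
lemma6 G (connected , acyclic) no-minor (k , 3≤k@(s≤s (s≤s (s≤s _))) , odd , r , c , c-injective , rel) =
  no-minor (k , 3≤k , odd , StarMinor.flowStar-minor G acyclic (Submatrix.starPattern G acyclic r c c-injective rel) connected)
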